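{- Let $n\ge2$ and for $m=1,\dots,n-1$ let $\mathbf{z}_m=\mathbf{e}_m\mathbf{h}_{n-m}\in\mathrm{A}_n$. Then $\mathbf{z}_1,\dots,\mathbf{z}_{n-1}$ are central elements of $\mathrm{A}_n$, and $\mathbf{z}_k\mathbf{z}_l=0$ for $k\neq l$.
   Context: The affine nil-Temperley–Lieb algebra $\mathrm{A}_n$ is the associative unital $\mathbb{Z}$-algebra with generators $a_i$, $i\in\mathbb{Z}/n\mathbb{Z}$, and relations $a_ia_i=a_ia_{i+1}a_i=a_{i+1}a_ia_{i+1}=0$ for all $i$, and $a_ia_j=a_ja_i$ if $i-j\not\equiv\pm1\pmod n$. For a proper subset $I\subsetneq\mathbb{Z}/n\mathbb{Z}$, $\prod^{\circlearrowright}_{i\in I}a_i$ is the product of the $a_i$, $i\in I$, in any order in which $a_{i+1}$ precedes $a_i$ whenever $i,i+1\in I$, and $\prod^{\circlearrowleft}_{i\in I}a_i$ is the product in any order in which $a_i$ precedes $a_{i+1}$ whenever $i,i+1\in I$. For $1\le r\le n-1$: $\mathbf{e}_r=\sum_{|I|=r}\prod^{\circlearrowright}_{i\in I}a_i$ and $\mathbf{h}_r=\sum_{|I|=r}\prod^{\circlearrowleft}_{i\in I}a_i$, sums over $r$-element subsets $I$ of $\mathbb{Z}/n\mathbb{Z}$. (In the paper $\mathbf{z}_m$ is defined as the sum of monomials over the $\binom nm$ circular ribbons of type $(m,n)$, and it is shown that this equals $\mathbf{e}_m\mathbf{h}_{n-m}$.) -}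

module Defs where

open import Data.Nat using (ℕ; zero; suc; _∸_; _≡ᵇ_)
open import Data.Nat.DivMod using (_mod_)
open import Data.Fin using (Fin; toℕ)
open import Data.Fin.Subset using (Subset; ∣_∣)
open import Data.Bool using (Bool; true; false)
open import Data.Vec using (Vec; []; _∷_; lookup)
open import Data.List using (List; []; _∷_; map; foldr; filterᵇ; _++_)
open import Data.Maybe using (Maybe; just; nothing)
open import Relation.Binary.PropositionalEquality using (_≡_)
open import Relation.Nullary using (¬_)

-- Cyclic indices ℤ/nℤ, represented by Fin n.

next : {n : ℕ} → Fin n → Fin n
next {suc k} i = (suc (toℕ i)) mod (suc k)

prev : {n : ℕ} → Fin n → Fin n
prev {suc k} i = (toℕ i Data.Nat.+ k) mod (suc k)

-- Terms of the free unital associative ℤ-algebra (= free ring) on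
-- generators a_i, i ∈ ℤ/nℤ.

infixl 6 _+_
infixl 7 _*_
infix  4 _≈_

data Tm (n : ℕ) : Set where
  a   : Fin n → Tm n
  0#  : Tm n
  1#  : Tm n
  _+_ : Tm n → Tm n → Tm n
  _*_ : Tm n → Tm n → Tm n
  -_  : Tm n → Tm n

-- The congruence defining A_n: generated by the ring axioms and the
-- defining relations of the affine nil-Temperley–Lieb algebra.
-- A_n is the quotient Tm n / _≈_ (presented as a setoid).
data _≈_ {n : ℕ} : Tm n → Tm n → Set where
  ≈-refl  : ∀ {x} → x ≈ x
  ≈-sym   : ∀ {x y} → x ≈ y → y ≈ x
  ≈-trans : ∀ {x y z} → x ≈ y → y ≈ z → x ≈ z
  +-cong  : ∀ {x x' y y'} → x ≈ x' → y ≈ y' → x + y ≈ x' + y'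
  *-cong  : ∀ {x x' y y'} → x ≈ x' → y ≈ y' → x * y ≈ x' * y'
  neg-cong : ∀ {x x'} → x ≈ x' → - x ≈ - x'
  +-assoc   : ∀ x y z → (x + y) + z ≈ x + (y + z)
  +-comm    : ∀ x y → x + y ≈ y + x
  +-identityˡ : ∀ x → 0# + x ≈ x
  -‿inverseˡ : ∀ x → (- x) + x ≈ 0#
  *-assoc   : ∀ x y z → (x * y) * z ≈ x * (y * z)
  *-identityˡ : ∀ x → 1# * x ≈ x
  *-identityʳ : ∀ x → x * 1# ≈ x
  distribˡ  : ∀ x y z → x * (y + z) ≈ x * y + x * z
  distribʳ  : ∀ x y z → (y + z) * x ≈ y * x + z * x
  rel-sq    : ∀ i → a i * a i ≈ 0#
  rel-braid₁ : ∀ i → a i * a (next i) * a i ≈ 0#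
  rel-braid₂ : ∀ i → a (next i) * a i * a (next i) ≈ 0#
  rel-comm  : ∀ i j → ¬ (j ≡ next i) → ¬ (i ≡ next j) → a i * a j ≈ a j * a i

Σ' : {n : ℕ} → List (Tm n) → Tm n
Σ' = foldr _+_ 0#

Π' : {n : ℕ} → List (Tm n) → Tm n
Π' = foldr _*_ 1#

allSubsets : (n : ℕ) → List (Subset n)
allSubsets zero    = [] ∷ []
allSubsets (suc n) = map (true ∷_) (allSubsets n) ++ map (false ∷_) (allSubsets n)

subsetsOfSize : (n r : ℕ) → List (Subset n)
subsetsOfSize n r = filterᵇ (λ I → ∣ I ∣ ≡ᵇ r) (allSubsets n)

firstOut : {n : ℕ} → Subset n → Maybe (Fin n)
firstOut []          = nothing
firstOut (false ∷ I) = just Data.Fin.zero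
firstOut (true ∷ I)  = Data.Maybe.map Data.Fin.suc (firstOut I)

walkDown : {n : ℕ} → ℕ → Fin n → List (Fin n)
walkDown zero    x = []
walkDown (suc k) x = x ∷ walkDown k (prev x)

walkUp : {n : ℕ} → ℕ → Fin n → List (Fin n)
walkUp zero    x = []
walkUp (suc k) x = x ∷ walkUp k (next x)

-- ∏^↻_{i∈I} a_i for a proper subset I: with j ∉ I, the product of the
-- a_i, i ∈ I, in the order j-1, j-2, …, j+1 (so a_{i+1} precedes a_i).
prodCW : {n : ℕ} → Subset n → Tm n
prodCW {n} I with firstOut I
... | just j  = Π' (map a (filterᵇ (lookup I) (walkDown (n ∸ 1) (prev j))))
... | nothing = 1#   -- never used: only proper subsets occur below

-- ∏^↺_{i∈I} a_i: order j+1, j+2, …, j-1 (so a_i precedes a_{i+1}).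
prodCCW : {n : ℕ} → Subset n → Tm n
prodCCW {n} I with firstOut I
... | just j  = Π' (map a (filterᵇ (lookup I) (walkUp (n ∸ 1) (next j))))
... | nothing = 1#   -- never used

𝐞 : (n r : ℕ) → Tm n
𝐞 n r = Σ' (map prodCW (subsetsOfSize n r))

𝐡 : (n r : ℕ) → Tm n
𝐡 n r = Σ' (map prodCCW (subsetsOfSize n r))

𝐳 : (n m : ℕ) → Tm n
𝐳 n m = 𝐞 n m * 𝐡 n (n ∸ m)

-- Expanding 𝐞_m 𝐡_{n−m}, the clockwise monomial of an m-subset I times the counterclockwise
-- monomial of an (n−m)-subset J vanishes unless J = ∁ I: otherwise, walking around the circle,
-- there is a j ∈ I ∩ J with j − 1 ∉ I ∩ J, and between the two occurrences of a_j there are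
-- only generators commuting with a_j and at most one neighbour a_{j±1}, so a_j a_j = 0 or
-- a_j a_{j±1} a_j = 0 kills the term. Hence 𝐳_m = Σ_{|I| = m} 𝐌 I, where 𝐌 I is the product
-- of all generators in an order in which a_{x+1} precedes a_x exactly when x + 1 ∈ I (all such
-- orders give the same element). The same argument, at a point where I and J disagree in the
-- right way, gives 𝐌 I · 𝐌 J = 0 for I ≠ J, whence 𝐳_k 𝐳_l = 0. Finally a_j 𝐌 I = 0 unless
-- j ∉ I ∋ j + 1, in which case it is 𝐌 I' a_j with I' obtained by exchanging j and j + 1,
-- and 𝐌 I a_j = 0 unless j ∈ I ∌ j + 1; exchanging is a size-preserving involution, so
-- every a_j commutes with 𝐳_m, and therefore so does every element.

module Submission where

open import Defs
open import Algebra.Bundles using (Ring)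
import Algebra.Consequences.Setoid as Consequences
import Algebra.Properties.Ring as RingProperties
open import Data.Bool as Bool using (Bool; true; false; not; _∧_; if_then_else_; T?)
open import Data.Bool.Properties using (T-≡)
open import Data.Empty using (⊥-elim)
open import Data.Fin using (Fin; toℕ; zero; suc)
open import Data.Fin.Properties using (toℕ-fromℕ<; toℕ-injective; toℕ<n; _≟_; ¬∀⟶∃¬)
open import Data.Fin.Subset using (Subset; ∣_∣; ∁)
open import Data.Fin.Subset.Properties using (∣∁p∣≡n∸∣p∣; ∣p∣≤n)
open import Data.List using (List; []; _∷_; map; _++_; filterᵇ; iterate)
open import Data.List.Properties using (++-assoc)
open import Data.List.Membership.Propositional using (_∈_; _∉_)
open import Data.List.Membership.Propositional.Properties
  using (∈-++⁺ˡ; ∈-++⁺ʳ; ∈-++⁻; ∈-map⁺; ∈-map⁻; ∈-filter⁺; ∈-filter⁻; ∈-∃++)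
open import Data.List.Relation.Unary.All as All using (All; []; _∷_)
import Data.List.Relation.Unary.All.Properties as All
open import Data.List.Relation.Unary.AllPairs using ([]; _∷_)
open import Data.List.Relation.Unary.Any using (here; there; any?)
open import Data.List.Relation.Unary.Unique.Propositional using (Unique)
open import Data.List.Relation.Unary.Unique.Propositional.Properties
  using (Unique[x∷xs]⇒x∉xs; filter⁺; ++⁺; map⁺)
open import Data.Maybe using (just; nothing)
open import Data.Nat using (ℕ; zero; suc; _≤_; _<_; _∸_; z≤n; s≤s) renaming (_+_ to _+ℕ_)
open import Data.Nat.DivMod using (_mod_; _%_; m%n<n; m<n⇒m%n≡m; n%n≡0; [m+n]%n≡m%n)
import Data.Nat.Properties as ℕ
open import Data.Product using (∃; _×_; _,_; proj₁; proj₂)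
open import Data.Sum as Sum using (_⊎_; inj₁; inj₂; [_,_]′)
open import Data.Vec using ([]; _∷_; lookup; _[_]≔_)
open import Data.Vec.Properties
  using (lookup-map; tabulate∘lookup; tabulate-cong; lookup∘update; lookup∘update′)
open import Function using (_∘_; id; Equivalence)
open import Level using (0ℓ)
open import Relation.Binary.Bundles using (Setoid)
open import Relation.Binary.Definitions using (DecidableEquality)
open import Relation.Binary.PropositionalEquality
  using (_≡_; _≢_; refl; sym; trans; cong; cong₂; subst; subst₂)
open import Relation.Nullary using (¬_; yes; no)

true≢false : true ≢ false
true≢false ()

χ : Bool → ℕ
χ true  = 1
χ false = 0

χ-< : ∀ {b c} → χ b < χ c → b ≡ false × c ≡ true
χ-< {false} {true} _         = refl , refl
χ-< {true}  {true} (s≤s ())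

∧≡true : ∀ {b c} → b ∧ c ≡ true → b ≡ true × c ≡ true
∧≡true {true} {true} _ = refl , refl

∧≡false : ∀ {b c} → b ∧ c ≡ false → b ≡ false ⊎ c ≡ false
∧≡false {false} _   = inj₁ refl
∧≡false {true}  c≡f = inj₂ c≡f

not≡true : ∀ {b} → not b ≡ true → b ≡ false
not≡true {false} _ = refl

not≡false : ∀ {b} → not b ≡ false → b ≡ true
not≡false {true} _ = refl

≈-setoid : ℕ → Setoid 0ℓ 0ℓ
≈-setoid n = record
  { Carrier = Tm n ; _≈_ = _≈_
  ; isEquivalence = record { refl = ≈-refl ; sym = ≈-sym ; trans = ≈-trans } }

Tm-ring : ℕ → Ring 0ℓ 0ℓ
Tm-ring n = record
  { isRing = record
    { +-isAbelianGroup = record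
      { isGroup = record
        { isMonoid = record
          { isSemigroup = record
            { isMagma = record { isEquivalence = Setoid.isEquivalence S ; ∙-cong = +-cong }
            ; assoc = +-assoc }
          ; identity = comm∧idˡ⇒id +-comm +-identityˡ }
        ; inverse = comm∧invˡ⇒inv +-comm -‿inverseˡ
        ; ⁻¹-cong = neg-cong }
      ; comm = +-comm }
    ; *-cong = *-cong
    ; *-assoc = *-assoc
    ; *-identity = *-identityˡ , *-identityʳ
    ; distrib = distribˡ , distribʳ } }
  where
  S = ≈-setoid n
  open Consequences S using (comm∧idˡ⇒id; comm∧invˡ⇒inv)

module _ {n : ℕ} where
  open Ring (Tm-ring n) public using (zeroˡ; zeroʳ; +-identityʳ)
  open RingProperties (Tm-ring n) public using (-‿distribˡ-*; -‿distribʳ-*)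

≈-if-∧-not : ∀ {n} {x y : Tm n} b c →
             (b ≡ false → x ≈ 0#) → (c ≡ true → x ≈ 0#) → (b ≡ true → c ≡ false → x ≈ y) →
             x ≈ (if b ∧ not c then y else 0#)
≈-if-∧-not false _     b-case _      _       = b-case refl
≈-if-∧-not true  true  _      c-case _       = c-case refl
≈-if-∧-not true  false _      _      bc-case = bc-case refl refl

≈-reflexive : ∀ {n} {x y : Tm n} → x ≡ y → x ≈ y
≈-reflexive refl = ≈-refl

module _ {n : ℕ} (z : Tm n) (commutes : ∀ i → a i * z ≈ z * a i) where
  open import Relation.Binary.Reasoning.Setoid (≈-setoid n)

  central : ∀ x → z * x ≈ x * z
  central (a i)   = ≈-sym (commutes i)
  central 0#      = ≈-trans (zeroʳ z) (≈-sym (zeroˡ z))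
  central 1#      = ≈-trans (*-identityʳ z) (≈-sym (*-identityˡ z))
  central (x + y) = ≈-trans (distribˡ z x y) (≈-trans (+-cong (central x) (central y)) (≈-sym (distribʳ z x y)))
  central (x * y) = begin
    z * (x * y)    ≈⟨ *-assoc z x y ⟨
    (z * x) * y    ≈⟨ *-cong (central x) ≈-refl ⟩
    (x * z) * y    ≈⟨ *-assoc x z y ⟩
    x * (z * y)    ≈⟨ *-cong ≈-refl (central y) ⟩
    x * (y * z)    ≈⟨ *-assoc x y z ⟨
    (x * y) * z    ∎
  central (- x)   = begin
    z * (- x)      ≈⟨ -‿distribʳ-* z x ⟨
    - (z * x)      ≈⟨ neg-cong (central x) ⟩
    - (x * z)      ≈⟨ -‿distribˡ-* x z ⟩
    (- x) * z      ∎

module _ {n : ℕ} where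
  open import Relation.Binary.Reasoning.Setoid (≈-setoid n)

  ∑ : {A : Set} → List A → (A → Tm n) → Tm n
  ∑ xs f = Σ' (map f xs)

  ∑-++ : {A : Set} (xs ys : List A) (f : A → Tm n) → ∑ (xs ++ ys) f ≈ ∑ xs f + ∑ ys f
  ∑-++ []       ys f = ≈-sym (+-identityˡ _)
  ∑-++ (x ∷ xs) ys f = ≈-trans (+-cong ≈-refl (∑-++ xs ys f)) (≈-sym (+-assoc _ _ _))

  ∑-distribʳ : {A : Set} (xs : List A) (f : A → Tm n) (y : Tm n) → ∑ xs f * y ≈ ∑ xs (λ x → f x * y)
  ∑-distribʳ []       f y = zeroˡ y
  ∑-distribʳ (x ∷ xs) f y = ≈-trans (distribʳ y (f x) _) (+-cong ≈-refl (∑-distribʳ xs f y))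

  ∑-distribˡ : {A : Set} (xs : List A) (f : A → Tm n) (y : Tm n) → y * ∑ xs f ≈ ∑ xs (λ x → y * f x)
  ∑-distribˡ []       f y = zeroʳ y
  ∑-distribˡ (x ∷ xs) f y = ≈-trans (distribˡ y (f x) _) (+-cong ≈-refl (∑-distribˡ xs f y))

  ∑-cong : {A : Set} (xs : List A) {f g : A → Tm n} → (∀ x → x ∈ xs → f x ≈ g x) → ∑ xs f ≈ ∑ xs g
  ∑-cong []       f≈g = ≈-refl
  ∑-cong (x ∷ xs) f≈g = +-cong (f≈g x (here refl)) (∑-cong xs (λ y y∈ → f≈g y (there y∈)))

  ∑-zero : {A : Set} (xs : List A) {f : A → Tm n} → (∀ x → x ∈ xs → f x ≈ 0#) → ∑ xs f ≈ 0#
  ∑-zero []       f≈0 = ≈-refl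
  ∑-zero (x ∷ xs) f≈0 =
    ≈-trans (+-cong (f≈0 x (here refl)) (∑-zero xs (λ y y∈ → f≈0 y (there y∈)))) (+-identityˡ 0#)

  ∑-map : {A B : Set} (xs : List A) (g : A → B) (f : B → Tm n) → ∑ (map g xs) f ≈ ∑ xs (λ x → f (g x))
  ∑-map []       g f = ≈-refl
  ∑-map (x ∷ xs) g f = +-cong ≈-refl (∑-map xs g f)

module _ {A : Set} where

  ∈-insert : ∀ {x} y (p q : List A) → x ∈ p ++ q → x ∈ p ++ y ∷ q
  ∈-insert y []      q x∈       = there x∈
  ∈-insert y (z ∷ p) q (here e) = here e
  ∈-insert y (z ∷ p) q (there x∈) = there (∈-insert y p q x∈)

  ∈-delete : ∀ {x y} (p q : List A) → x ∈ p ++ y ∷ q → x ≢ y → x ∈ p ++ q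
  ∈-delete []      q (here e)   x≢y = ⊥-elim (x≢y e)
  ∈-delete []      q (there x∈) x≢y = x∈
  ∈-delete (z ∷ p) q (here e)   x≢y = here e
  ∈-delete (z ∷ p) q (there x∈) x≢y = there (∈-delete p q x∈ x≢y)

  All-delete : ∀ {P : A → Set} {x} (p q : List A) → All P (p ++ x ∷ q) → All P (p ++ q)
  All-delete []      q (_ ∷ ps)  = ps
  All-delete (y ∷ p) q (py ∷ ps) = py ∷ All-delete p q ps

  unique-delete : ∀ {x} (p q : List A) → Unique (p ++ x ∷ q) → Unique (p ++ q)
  unique-delete []      q (_ ∷ u)  = u
  unique-delete (y ∷ p) q (y≢ ∷ u) = All-delete p q y≢ ∷ unique-delete p q u

  unique-middle : ∀ {x} (p q : List A) → Unique (p ++ x ∷ q) → x ∉ p ++ q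
  unique-middle []      q u        x∈          = Unique[x∷xs]⇒x∉xs u x∈
  unique-middle (y ∷ p) q (y≢ ∷ u) (here refl) = All.lookup y≢ (∈-++⁺ʳ p (here refl)) refl
  unique-middle (y ∷ p) q (_ ∷ u)  (there x∈)  = unique-middle p q u x∈

  unique-++⁻ˡ : ∀ (u : List A) {v} → Unique (u ++ v) → Unique u
  unique-++⁻ˡ []      _          = []
  unique-++⁻ˡ (x ∷ u) (x≢ ∷ uv) = All.++⁻ˡ u x≢ ∷ unique-++⁻ˡ u uv

  unique-++⁻ʳ : ∀ (u : List A) {v} → Unique (u ++ v) → Unique v
  unique-++⁻ʳ []      uv       = uv
  unique-++⁻ʳ (x ∷ u) (_ ∷ uv) = unique-++⁻ʳ u uv

  unique-tail : ∀ {x} {w : List A} → Unique (x ∷ w) → Unique w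
  unique-tail (_ ∷ u) = u

  data Before (x y : A) : List A → Set where
    first : ∀ {w} → y ∈ w → Before x y (x ∷ w)
    later : ∀ {z w} → Before x y w → Before x y (z ∷ w)

  Before-∈ˡ : ∀ {x y w} → Before x y w → x ∈ w
  Before-∈ˡ (first _) = here refl
  Before-∈ˡ (later b) = there (Before-∈ˡ b)

  Before-∈ʳ : ∀ {x y w} → Before x y w → y ∈ w
  Before-∈ʳ (first y∈) = there y∈
  Before-∈ʳ (later b)  = there (Before-∈ʳ b)

  Before-asym : ∀ {x y w} → Unique w → Before x y w → ¬ Before y x w
  Before-asym u        (first y∈) (first _)  = Unique[x∷xs]⇒x∉xs u y∈
  Before-asym u        (first _)  (later b)  = Unique[x∷xs]⇒x∉xs u (Before-∈ʳ b)
  Before-asym u        (later b)  (first _)  = Unique[x∷xs]⇒x∉xs u (Before-∈ʳ b)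
  Before-asym (_ ∷ u)  (later b)  (later b') = Before-asym u b b'

  Before-head : ∀ {x y w} → Unique (y ∷ w) → ¬ Before x y (y ∷ w)
  Before-head u (first y∈) = Unique[x∷xs]⇒x∉xs u y∈
  Before-head u (later b)  = Unique[x∷xs]⇒x∉xs u (Before-∈ʳ b)

  Before-after : ∀ {x y} (p q : List A) → y ∈ q → Before x y (p ++ x ∷ q)
  Before-after []      q y∈ = first y∈
  Before-after (z ∷ p) q y∈ = later (Before-after p q y∈)

  Before-before : ∀ {x y} (p q : List A) → y ∈ p → Before y x (p ++ x ∷ q)
  Before-before (z ∷ p) q (here refl) = first (∈-++⁺ʳ p (here refl))
  Before-before (z ∷ p) q (there y∈)  = later (Before-before p q y∈)

  Before-++⁺ˡ : ∀ {x y} (u v : List A) → Before x y u → Before x y (u ++ v)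
  Before-++⁺ˡ (_ ∷ u) v (first y∈) = first (∈-++⁺ˡ y∈)
  Before-++⁺ˡ (_ ∷ u) v (later b)  = later (Before-++⁺ˡ u v b)

  Before-++⁺ʳ : ∀ {x y} (u v : List A) → Before x y v → Before x y (u ++ v)
  Before-++⁺ʳ []      v b = b
  Before-++⁺ʳ (_ ∷ u) v b = later (Before-++⁺ʳ u v b)

  Before-++⁺ : ∀ {x y} (u v : List A) → x ∈ u → y ∈ v → Before x y (u ++ v)
  Before-++⁺ (_ ∷ u) v (here refl) y∈ = first (∈-++⁺ʳ u y∈)
  Before-++⁺ (_ ∷ u) v (there x∈) y∈ = later (Before-++⁺ u v x∈ y∈)

  Before-insert : ∀ {x y} z (p q : List A) → Before x y (p ++ q) → Before x y (p ++ z ∷ q)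
  Before-insert z []      q b          = later b
  Before-insert z (w ∷ p) q (first y∈) = first (∈-insert z p q y∈)
  Before-insert z (w ∷ p) q (later b)  = later (Before-insert z p q b)

  Before-delete : ∀ {x y z} (p q : List A) → Before x y (p ++ z ∷ q) → x ≢ z → y ≢ z → Before x y (p ++ q)
  Before-delete []      q (first _)  x≢z y≢z = ⊥-elim (x≢z refl)
  Before-delete []      q (later b)  x≢z y≢z = b
  Before-delete (w ∷ p) q (first y∈) x≢z y≢z = first (∈-delete p q y∈ y≢z)
  Before-delete (w ∷ p) q (later b)  x≢z y≢z = later (Before-delete p q b x≢z y≢z)

  Before-filter : ∀ (f : A → Bool) {x y} (w : List A) → f x ≡ true → f y ≡ true →
                  Before x y w → Before x y (filterᵇ f w)
  Before-filter f (z ∷ w) fx fy (first y∈) with f z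
  ... | true = first (∈-filter⁺ (T? ∘ f) y∈ (Equivalence.from T-≡ fy))
  Before-filter f (z ∷ w) () fy (first y∈) | false
  Before-filter f (z ∷ w) fx fy (later b) with f z
  ... | true  = later (Before-filter f w fx fy b)
  ... | false = Before-filter f w fx fy b

  data AtMostOnce (y : A) : List A → Set where
    absent : ∀ {w} → y ∉ w → AtMostOnce y w
    once   : ∀ {p q} → y ∉ p ++ q → AtMostOnce y (p ++ y ∷ q)

  atMostOnce-++ˡ : ∀ {y} {u v : List A} → AtMostOnce y u → y ∉ v → AtMostOnce y (u ++ v)
  atMostOnce-++ˡ {u = u} (absent y∉u) y∉v = absent ([ y∉u , y∉v ]′ ∘ ∈-++⁻ u)
  atMostOnce-++ˡ {y} {v = v} (once {p} {q} y∉pq) y∉v =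
    subst (AtMostOnce y) (sym (++-assoc p (y ∷ q) v)) (once y∉p++q++v)
    where
    y∉p++q++v : y ∉ p ++ q ++ v
    y∉p++q++v y∈ with ∈-++⁻ p y∈
    ... | inj₁ y∈p = y∉pq (∈-++⁺ˡ y∈p)
    ... | inj₂ y∈qv = [ y∉pq ∘ ∈-++⁺ʳ p , y∉v ]′ (∈-++⁻ q y∈qv)

  atMostOnce-++ʳ : ∀ {y} {u v : List A} → y ∉ u → AtMostOnce y v → AtMostOnce y (u ++ v)
  atMostOnce-++ʳ {u = u} y∉u (absent y∉v) = absent ([ y∉u , y∉v ]′ ∘ ∈-++⁻ u)
  atMostOnce-++ʳ {y} {u} y∉u (once {p} {q} y∉pq) =
    subst (AtMostOnce y) (++-assoc u p (y ∷ q)) (once y∉u++p++q)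
    where
    y∉u++p++q : y ∉ (u ++ p) ++ q
    y∉u++p++q y∈ with ∈-++⁻ (u ++ p) y∈
    ... | inj₂ y∈q = y∉pq (∈-++⁺ʳ p y∈q)
    ... | inj₁ y∈up = [ y∉u , y∉pq ∘ ∈-++⁺ˡ ]′ (∈-++⁻ u y∈up)

  unique⇒atMostOnce : DecidableEquality A → ∀ {y w} → Unique w → AtMostOnce y w
  unique⇒atMostOnce _≟_ {y} {w} u with any? (y ≟_) w
  ... | no  y∉w = absent y∉w
  ... | yes y∈w with ∈-∃++ y∈w
  ...   | p , q , refl = once (unique-middle p q u)

module _ {n : ℕ} {A : Set} where
  open import Relation.Binary.Reasoning.Setoid (≈-setoid n)

  ∑-point : (f : A → Tm n) {xs : List A} {x₀ : A} → Unique xs → x₀ ∈ xs →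
            (∀ y → y ∈ xs → y ≢ x₀ → f y ≈ 0#) → ∑ xs f ≈ f x₀
  ∑-point f {x ∷ xs} u (here refl) others =
    ≈-trans (+-cong ≈-refl (∑-zero xs (λ y y∈ → others y (there y∈) (λ { refl → Unique[x∷xs]⇒x∉xs u y∈ }))))
      (+-identityʳ _)
  ∑-point f {x ∷ xs} u (there x₀∈) others =
    ≈-trans (+-cong (others x (here refl) (λ { refl → Unique[x∷xs]⇒x∉xs u x₀∈ }))
                    (∑-point f (unique-tail u) x₀∈ (λ y y∈ → others y (there y∈))))
            (+-identityˡ _)

  ∑-extract : (f : A → Tm n) (p q : List A) (x : A) → ∑ (p ++ x ∷ q) f ≈ f x + ∑ (p ++ q) f
  ∑-extract f p q x = begin
    ∑ (p ++ x ∷ q) f              ≈⟨ ∑-++ p (x ∷ q) f ⟩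
    ∑ p f + (f x + ∑ q f)         ≈⟨ +-assoc _ _ _ ⟨
    (∑ p f + f x) + ∑ q f         ≈⟨ +-cong (+-comm _ _) ≈-refl ⟩
    (f x + ∑ p f) + ∑ q f         ≈⟨ +-assoc _ _ _ ⟩
    f x + (∑ p f + ∑ q f)         ≈⟨ +-cong ≈-refl (∑-++ p q f) ⟨
    f x + ∑ (p ++ q) f            ∎

  ∑-sameElements : (f : A → Tm n) (xs ys : List A) → Unique xs → Unique ys →
                   (∀ x → x ∈ xs → x ∈ ys) → (∀ x → x ∈ ys → x ∈ xs) → ∑ xs f ≈ ∑ ys f
  ∑-sameElements f []       []       _  _  _     _     = ≈-refl
  ∑-sameElements f []       (y ∷ ys) _  _  _     ys⊆[] with () ← ys⊆[] y (here refl)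
  ∑-sameElements f (x ∷ xs) ys       ux uy xs⊆ys ys⊆xs with ∈-∃++ (xs⊆ys x (here refl))
  ... | p , q , refl = begin
    f x + ∑ xs f          ≈⟨ +-cong ≈-refl (∑-sameElements f xs (p ++ q) (unique-tail ux) (unique-delete p q uy)
                                                                xs⊆pq pq⊆xs) ⟩
    f x + ∑ (p ++ q) f    ≈⟨ ∑-extract f p q x ⟨
    ∑ (p ++ x ∷ q) f      ∎
    where
    xs⊆pq : ∀ z → z ∈ xs → z ∈ p ++ q
    xs⊆pq z z∈ = ∈-delete p q (xs⊆ys z (there z∈)) (λ { refl → Unique[x∷xs]⇒x∉xs ux z∈ })
    pq⊆xs : ∀ z → z ∈ p ++ q → z ∈ xs
    pq⊆xs z z∈ with ys⊆xs z (∈-insert x p q z∈)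
    ... | here refl = ⊥-elim (unique-middle p q uy z∈)
    ... | there z∈xs = z∈xs

-- Walking around a cycle

record CyclicDistance {A : Set} (s : A → A) (n : ℕ) : Set where
  field
    dist       : A → A → ℕ
    dist-self  : ∀ y → dist y y ≡ 0
    dist-step  : ∀ {y z} → y ≢ z → dist y z ≡ suc (dist (s y) z)
    dist-<     : ∀ y z → dist y z < n
    dist-back  : ∀ y → suc (dist (s y) y) ≡ n
    dist-stepʳ : ∀ y z → suc (dist y z) < n → dist y (s z) ≡ suc (dist y z)

module Walk {A : Set} (_≟_ : DecidableEquality A) {s : A → A} {n : ℕ} (D : CyclicDistance s n) where
  open CyclicDistance D

  dist≡0⇒≡ : ∀ {y z} → dist y z ≡ 0 → y ≡ z
  dist≡0⇒≡ {y} {z} d≡0 with y ≟ z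
  ... | yes y≡z = y≡z
  ... | no  y≢z = ⊥-elim (ℕ.0≢1+n (trans (sym d≡0) (dist-step y≢z)))

  ∈-iterate⁻ : ∀ k y {z} → z ∈ iterate s y k → dist y z < k
  ∈-iterate⁻ (suc k) y (here refl) = subst (_< suc k) (sym (dist-self y)) (s≤s z≤n)
  ∈-iterate⁻ (suc k) y {z} (there z∈) with y ≟ z
  ... | yes refl = subst (_< suc k) (sym (dist-self y)) (s≤s z≤n)
  ... | no  y≢z  = subst (_< suc k) (sym (dist-step y≢z)) (s≤s (∈-iterate⁻ k (s y) z∈))

  ∈-iterate⁺ : ∀ k y {z} → dist y z < k → z ∈ iterate s y k
  ∈-iterate⁺ (suc k) y {z} d<k with y ≟ z
  ... | yes refl = here refl
  ... | no  y≢z  = there (∈-iterate⁺ k (s y) (ℕ.≤-pred (subst (_< suc k) (dist-step y≢z) d<k)))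

  dist-injective : ∀ m y {z z'} → dist y z ≡ m → dist y z' ≡ m → z ≡ z'
  dist-injective zero    y d≡0 d'≡0 = trans (sym (dist≡0⇒≡ d≡0)) (dist≡0⇒≡ d'≡0)
  dist-injective (suc m) y {z} {z'} d≡ d'≡ with y ≟ z | y ≟ z'
  ... | yes refl | _        = ⊥-elim (ℕ.0≢1+n (trans (sym (dist-self y)) d≡))
  ... | no _     | yes refl = ⊥-elim (ℕ.0≢1+n (trans (sym (dist-self y)) d'≡))
  ... | no y≢z   | no y≢z'  = dist-injective m (s y)
                                (ℕ.suc-injective (trans (sym (dist-step y≢z)) d≡))
                                (ℕ.suc-injective (trans (sym (dist-step y≢z')) d'≡))

  iterate-unique : ∀ k y → k ≤ n → Unique (iterate s y k)
  iterate-unique zero    y _    = []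
  iterate-unique (suc k) y k<n  =
    All.¬Any⇒All¬ _ (λ y∈ → ℕ.<⇒≱ (∈-iterate⁻ k (s y) y∈)
                                   (ℕ.≤-pred (subst (suc k ≤_) (sym (dist-back y)) k<n)))
    ∷ iterate-unique k (s y) (ℕ.≤-trans (ℕ.n≤1+n k) k<n)

  before-in-iterate : ∀ k y {z} → suc (dist y z) < k → Before z (s z) (iterate s y k)
  before-in-iterate (suc k) y {z} lt with y ≟ z
  ... | yes refl = first (∈-iterate⁺ k (s y) (subst (_< k) (sym (dist-self (s y)))
                     (ℕ.≤-trans (s≤s z≤n) (ℕ.≤-pred (subst (λ t → suc t < suc k) (dist-self y) lt)))))
  ... | no  y≢z  = later (before-in-iterate k (s y) (ℕ.≤-pred (subst (λ t → suc t < suc k) (dist-step y≢z) lt)))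

  iterate-before : ∀ k y {z} → k < n → z ∈ iterate s y k → s z ∈ iterate s y k →
                   Before z (s z) (iterate s y k)
  iterate-before k y {z} k<n z∈ sz∈ with suc (dist y z) ℕ.<? k
  ... | yes lt = before-in-iterate k y lt
  ... | no  ≮k =
    ⊥-elim (ℕ.<⇒≱ (∈-iterate⁻ k y sz∈) (subst (k ≤_) (sym (dist-stepʳ y z d<n)) (ℕ.≮⇒≥ ≮k)))
    where d<n = ℕ.≤-<-trans (∈-iterate⁻ k y z∈) k<n

  ascent : (f : A → ℕ) {y z : A} → f y < f z → ∃ λ x → f x < f (s x)
  ascent f {y} {z} = go (dist y z) y refl
    where
    go : ∀ m y → dist y z ≡ m → f y < f z → ∃ λ x → f x < f (s x)
    go zero    y d≡0 fy<fz = ⊥-elim (ℕ.<-irrefl (cong f (dist≡0⇒≡ d≡0)) fy<fz)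
    go (suc m) y d≡ fy<fz with y ≟ z
    ... | yes refl = ⊥-elim (ℕ.<-irrefl refl fy<fz)
    ... | no  y≢z with f y ℕ.<? f (s y)
    ...   | yes up = y , up
    ...   | no ¬up = go m (s y) (ℕ.suc-injective (trans (sym (dist-step y≢z)) d≡))
                            (ℕ.≤-<-trans (ℕ.≮⇒≥ ¬up) fy<fz)

module Cyclic (k : ℕ) where
  N : ℕ
  N = suc k

  toℕ-mod : ∀ m → toℕ (m mod N) ≡ m % N
  toℕ-mod m = toℕ-fromℕ< (m%n<n m N)

  toℕ-next : (x : Fin N) → toℕ x < k → toℕ (next x) ≡ suc (toℕ x)
  toℕ-next x x<k = trans (toℕ-mod (suc (toℕ x))) (m<n⇒m%n≡m (s≤s x<k))

  toℕ-next-last : (x : Fin N) → toℕ x ≡ k → toℕ (next x) ≡ 0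
  toℕ-next-last x x≡k = trans (toℕ-mod (suc (toℕ x))) (trans (cong (λ t → suc t % N) x≡k) (n%n≡0 N))

  predᶜ : ℕ → ℕ
  predᶜ zero    = k
  predᶜ (suc t) = t

  toℕ-prev : (x : Fin N) → toℕ (prev x) ≡ predᶜ (toℕ x)
  toℕ-prev x = trans (toℕ-mod (toℕ x +ℕ k)) ([t+k]%N (toℕ x) (toℕ<n x))
    where
    [t+k]%N : ∀ t → t < N → (t +ℕ k) % N ≡ predᶜ t
    [t+k]%N zero    _   = m<n⇒m%n≡m (ℕ.n<1+n k)
    [t+k]%N (suc t) t<N = trans (cong (_% N) (sym (ℕ.+-suc t k)))
                            (trans ([m+n]%n≡m%n t N) (m<n⇒m%n≡m (ℕ.<-trans (ℕ.n<1+n t) t<N)))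

  ≮k⇒≡k : (x : Fin N) → ¬ toℕ x < k → toℕ x ≡ k
  ≮k⇒≡k x x≮k = ℕ.≤-antisym (ℕ.≤-pred (toℕ<n x)) (ℕ.≮⇒≥ x≮k)

  prev-next : (x : Fin N) → prev (next x) ≡ x
  prev-next x with toℕ x ℕ.<? k
  ... | yes x<k = toℕ-injective (trans (toℕ-prev (next x)) (cong predᶜ (toℕ-next x x<k)))
  ... | no  x≮k = toℕ-injective (trans (toℕ-prev (next x)) (trans (cong predᶜ (toℕ-next-last x x≡k)) (sym x≡k)))
    where x≡k = ≮k⇒≡k x x≮k

  next-prev : (x : Fin N) → next (prev x) ≡ x
  next-prev x = toℕ-injective (by-value (toℕ x) refl (toℕ<n x))
    where
    by-value : ∀ t → toℕ x ≡ t → t < N → toℕ (next (prev x)) ≡ toℕ x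
    by-value zero    x≡0 _   = trans (toℕ-next-last (prev x) (trans (toℕ-prev x) (cong predᶜ x≡0))) (sym x≡0)
    by-value (suc t) x≡t t<N = trans (toℕ-next (prev x) (subst (_< k) (sym p≡t) (ℕ.≤-pred t<N)))
                                     (trans (cong suc p≡t) (sym x≡t))
      where p≡t = trans (toℕ-prev x) (cong predᶜ x≡t)

  next≢id : 1 ≤ k → (x : Fin N) → next x ≢ x
  next≢id 1≤k x nx≡x with toℕ x ℕ.<? k
  ... | yes x<k = ℕ.1+n≢n (trans (sym (toℕ-next x x<k)) (cong toℕ nx≡x))
  ... | no  x≮k = ℕ.<⇒≢ 1≤k (trans (sym (toℕ-next-last x x≡k)) (trans (cong toℕ nx≡x) x≡k))
    where x≡k = ≮k⇒≡k x x≮k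

  down : ℕ → ℕ → ℕ
  down p q with q ℕ.≤? p
  ... | yes _ = p ∸ q
  ... | no  _ = N +ℕ p ∸ q

  down-≥ : ∀ p q → q ≤ p → down p q ≡ p ∸ q
  down-≥ p q q≤p with q ℕ.≤? p
  ... | yes _   = refl
  ... | no  q≰p = ⊥-elim (q≰p q≤p)

  down-< : ∀ p q → p < q → down p q ≡ N +ℕ p ∸ q
  down-< p q p<q with q ℕ.≤? p
  ... | yes q≤p = ⊥-elim (ℕ.<⇒≱ p<q q≤p)
  ... | no  _   = refl

  down-self : ∀ p → down p p ≡ 0
  down-self p = trans (down-≥ p p ℕ.≤-refl) (ℕ.n∸n≡0 p)

  down-bounded : ∀ p q → p < N → q < N → down p q < N
  down-bounded p q p<N q<N with q ℕ.≤? p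
  ... | yes _   = ℕ.≤-<-trans (ℕ.m∸n≤m p q) p<N
  ... | no  q≰p = ℕ.+-cancelʳ-< q (N +ℕ p ∸ q) N
                    (subst (_< N +ℕ q) (sym (ℕ.m∸n+n≡m q≤N+p)) (ℕ.+-monoʳ-< N (ℕ.≰⇒> q≰p)))
    where q≤N+p = ℕ.≤-trans (ℕ.<⇒≤ q<N) (ℕ.m≤m+n N p)

  ∸-suc : ∀ p c → suc c ≤ p → p ∸ c ≡ suc (p ∸ suc c)
  ∸-suc (suc p) c (s≤s c≤p) = ℕ.+-∸-assoc 1 c≤p

  down-step : ∀ p q → q < N → p ≢ q → down p q ≡ suc (down (predᶜ p) q)
  down-step zero    zero    _   p≢q = ⊥-elim (p≢q refl)
  down-step zero    (suc q) q<N _   =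
    trans (down-< 0 (suc q) (s≤s z≤n))
      (trans (cong (_∸ suc q) (ℕ.+-identityʳ N))
        (trans (∸-suc k q (ℕ.≤-pred q<N)) (sym (cong suc (down-≥ k (suc q) (ℕ.≤-pred q<N))))))
  down-step (suc p) q q<N p≢q with q ℕ.≤? p
  ... | yes q≤p = trans (down-≥ (suc p) q (ℕ.m≤n⇒m≤1+n q≤p)) (ℕ.+-∸-assoc 1 q≤p)
  ... | no  q≰p = trans (down-< (suc p) q (ℕ.≤∧≢⇒< (ℕ.≰⇒> q≰p) p≢q))
                    (trans (cong (_∸ q) (ℕ.+-suc N p))
                      (ℕ.+-∸-assoc 1 (ℕ.≤-trans (ℕ.<⇒≤ q<N) (ℕ.m≤m+n N p))))

  down-stepʳ : ∀ p c → p < N → c < N → p ≢ predᶜ c → down p (predᶜ c) ≡ suc (down p c)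
  down-stepʳ p zero    p<N _   p≢k =
    trans (down-< p k p<k)
      (trans (cong (λ t → suc t ∸ k) (ℕ.+-comm k p))
        (trans (ℕ.m+n∸n≡m (suc p) k) (cong suc (sym (down-≥ p 0 z≤n)))))
    where p<k = ℕ.≤∧≢⇒< (ℕ.≤-pred p<N) p≢k
  down-stepʳ p (suc c) p<N c<N p≢c with c ℕ.≤? p
  ... | yes c≤p = trans (∸-suc p c c<p) (cong suc (sym (down-≥ p (suc c) c<p)))
    where c<p = ℕ.≤∧≢⇒< c≤p (p≢c ∘ sym)
  ... | no  c≰p = trans (∸-suc (N +ℕ p) c (ℕ.≤-trans (ℕ.<⇒≤ c<N) (ℕ.m≤m+n N p)))
                    (cong suc (sym (down-< p (suc c) (ℕ.m≤n⇒m≤1+n (ℕ.≰⇒> c≰p)))))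

  down-back : ∀ c → down (predᶜ c) c ≡ k
  down-back zero    = down-≥ k 0 z≤n
  down-back (suc c) = trans (down-< c (suc c) (ℕ.n<1+n c)) (ℕ.m+n∸n≡m k c)

  dist↓ : Fin N → Fin N → ℕ
  dist↓ y z = down (toℕ y) (toℕ z)

  dist↓-prevˡ : ∀ {y z} → y ≢ z → dist↓ y z ≡ suc (dist↓ (prev y) z)
  dist↓-prevˡ {y} {z} y≢z = trans (down-step (toℕ y) (toℕ z) (toℕ<n z) (y≢z ∘ toℕ-injective))
                                  (cong (λ t → suc (down t (toℕ z))) (sym (toℕ-prev y)))

  dist↓-prevʳ : ∀ {y z} → y ≢ prev z → dist↓ y (prev z) ≡ suc (dist↓ y z)
  dist↓-prevʳ {y} {z} y≢pz = trans (cong (down (toℕ y)) (toℕ-prev z))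
    (down-stepʳ (toℕ y) (toℕ z) (toℕ<n y) (toℕ<n z) (λ e → y≢pz (toℕ-injective (trans e (sym (toℕ-prev z))))))

  dist↓-back : ∀ z → dist↓ (prev z) z ≡ k
  dist↓-back z = trans (cong (λ t → down t (toℕ z)) (toℕ-prev z)) (down-back (toℕ z))

  dist↓-next : ∀ z → dist↓ z (next z) ≡ k
  dist↓-next z = trans (cong (λ t → dist↓ t (next z)) (sym (prev-next z))) (dist↓-back (next z))

  dist↓-< : ∀ y z → dist↓ y z < N
  dist↓-< y z = down-bounded (toℕ y) (toℕ z) (toℕ<n y) (toℕ<n z)

  prev-distance : CyclicDistance prev N
  prev-distance = record
    { dist       = dist↓
    ; dist-self  = λ y → down-self (toℕ y)
    ; dist-step  = dist↓-prevˡ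
    ; dist-<     = dist↓-<
    ; dist-back  = λ y → cong suc (dist↓-back y)
    ; dist-stepʳ = stepʳ
    }
    where
    stepʳ : ∀ y z → suc (dist↓ y z) < N → dist↓ y (prev z) ≡ suc (dist↓ y z)
    stepʳ y z d<N with y ≟ prev z
    ... | yes refl = ⊥-elim (ℕ.<-irrefl refl (subst (λ t → suc t < N) (dist↓-back z) d<N))
    ... | no  y≢pz = dist↓-prevʳ {y} {z} y≢pz

  next-distance : CyclicDistance next N
  next-distance = record
    { dist       = λ y z → dist↓ z y
    ; dist-self  = λ y → down-self (toℕ y)
    ; dist-step  = λ {y} {z} y≢z → trans (cong (dist↓ z) (sym (prev-next y)))
                                     (dist↓-prevʳ {z} {next y} (λ z≡ → y≢z (sym (trans z≡ (prev-next y)))))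
    ; dist-<     = λ y z → dist↓-< z y
    ; dist-back  = λ y → cong suc (dist↓-next y)
    ; dist-stepʳ = stepʳ
    }
    where
    stepʳ : ∀ y z → suc (dist↓ z y) < N → dist↓ (next z) y ≡ suc (dist↓ z y)
    stepʳ y z d<N with next z ≟ y
    ... | yes refl = ⊥-elim (ℕ.<-irrefl refl (subst (λ t → suc t < N) (dist↓-next z) d<N))
    ... | no  nz≢y = trans (dist↓-prevˡ {next z} {y} nz≢y) (cong (λ t → suc (dist↓ t y)) (prev-next z))

walkDown≡iterate : ∀ {n} m (y : Fin n) → walkDown m y ≡ iterate prev y m
walkDown≡iterate zero    y = refl
walkDown≡iterate (suc m) y = cong (y ∷_) (walkDown≡iterate m (prev y))

walkUp≡iterate : ∀ {n} m (y : Fin n) → walkUp m y ≡ iterate next y m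
walkUp≡iterate zero    y = refl
walkUp≡iterate (suc m) y = cong (y ∷_) (walkUp≡iterate m (next y))

-- Monomials

module _ {n : ℕ} where
  open import Relation.Binary.Reasoning.Setoid (≈-setoid n)
  open import Algebra.Solver.Monoid (Ring.*-monoid (Tm-ring n)) using (solve; _⊕_; _⊜_)

  ⟦_⟧ : List (Fin n) → Tm n
  ⟦ w ⟧ = Π' (map a w)

  ⟦++⟧ : (u v : List (Fin n)) → ⟦ u ++ v ⟧ ≈ ⟦ u ⟧ * ⟦ v ⟧
  ⟦++⟧ []      v = ≈-sym (*-identityˡ _)
  ⟦++⟧ (x ∷ u) v = ≈-trans (*-cong ≈-refl (⟦++⟧ u v)) (≈-sym (*-assoc _ _ _))

  Commutes : Tm n → Fin n → Set
  Commutes x z = x * a z ≈ a z * x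

  commutes-⟦⟧ : ∀ x (w : List (Fin n)) → (∀ z → z ∈ w → Commutes x z) → x * ⟦ w ⟧ ≈ ⟦ w ⟧ * x
  commutes-⟦⟧ x []      _    = ≈-trans (*-identityʳ x) (≈-sym (*-identityˡ x))
  commutes-⟦⟧ x (z ∷ w) comm = begin
    x * (a z * ⟦ w ⟧)   ≈⟨ *-assoc _ _ _ ⟨
    (x * a z) * ⟦ w ⟧   ≈⟨ *-cong (comm z (here refl)) ≈-refl ⟩
    (a z * x) * ⟦ w ⟧   ≈⟨ *-assoc _ _ _ ⟩
    a z * (x * ⟦ w ⟧)   ≈⟨ *-cong ≈-refl (commutes-⟦⟧ x w (λ z' z'∈ → comm z' (there z'∈))) ⟩
    a z * (⟦ w ⟧ * x)   ≈⟨ *-assoc _ _ _ ⟨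
    (a z * ⟦ w ⟧) * x   ∎

  ⟦⟧-extractˡ : ∀ j (p q : List (Fin n)) → (∀ z → z ∈ p → Commutes (a j) z) →
                ⟦ p ++ j ∷ q ⟧ ≈ a j * ⟦ p ++ q ⟧
  ⟦⟧-extractˡ j p q comm = begin
    ⟦ p ++ j ∷ q ⟧          ≈⟨ ⟦++⟧ p (j ∷ q) ⟩
    ⟦ p ⟧ * (a j * ⟦ q ⟧)   ≈⟨ *-assoc _ _ _ ⟨
    (⟦ p ⟧ * a j) * ⟦ q ⟧   ≈⟨ *-cong (commutes-⟦⟧ (a j) p comm) ≈-refl ⟨
    (a j * ⟦ p ⟧) * ⟦ q ⟧   ≈⟨ *-assoc _ _ _ ⟩
    a j * (⟦ p ⟧ * ⟦ q ⟧)   ≈⟨ *-cong ≈-refl (⟦++⟧ p q) ⟨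
    a j * ⟦ p ++ q ⟧        ∎

  ⟦⟧-extractʳ : ∀ j (p q : List (Fin n)) → (∀ z → z ∈ q → Commutes (a j) z) →
                ⟦ p ++ j ∷ q ⟧ ≈ ⟦ p ++ q ⟧ * a j
  ⟦⟧-extractʳ j p q comm = begin
    ⟦ p ++ j ∷ q ⟧          ≈⟨ ⟦++⟧ p (j ∷ q) ⟩
    ⟦ p ⟧ * (a j * ⟦ q ⟧)   ≈⟨ *-cong ≈-refl (commutes-⟦⟧ (a j) q comm) ⟩
    ⟦ p ⟧ * (⟦ q ⟧ * a j)   ≈⟨ *-assoc _ _ _ ⟨
    (⟦ p ⟧ * ⟦ q ⟧) * a j   ≈⟨ *-cong (⟦++⟧ p q) ≈-refl ⟨
    ⟦ p ++ q ⟧ * a j        ∎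

  ⟦⟧-split-product : ∀ j (u₁ u₂ v₁ v₂ : List (Fin n)) →
    ⟦ u₁ ++ j ∷ u₂ ⟧ * ⟦ v₁ ++ j ∷ v₂ ⟧ ≈ ⟦ u₁ ⟧ * ((a j * ⟦ u₂ ++ v₁ ⟧ * a j) * ⟦ v₂ ⟧)
  ⟦⟧-split-product j u₁ u₂ v₁ v₂ = begin
    ⟦ u₁ ++ j ∷ u₂ ⟧ * ⟦ v₁ ++ j ∷ v₂ ⟧
      ≈⟨ *-cong (⟦++⟧ u₁ (j ∷ u₂)) (⟦++⟧ v₁ (j ∷ v₂)) ⟩
    (⟦ u₁ ⟧ * (a j * ⟦ u₂ ⟧)) * (⟦ v₁ ⟧ * (a j * ⟦ v₂ ⟧))
      ≈⟨ solve 5 (λ U₁ J U₂ V₁ V₂ → (U₁ ⊕ (J ⊕ U₂)) ⊕ (V₁ ⊕ (J ⊕ V₂)) ⊜ U₁ ⊕ (((J ⊕ (U₂ ⊕ V₁)) ⊕ J) ⊕ V₂))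
               ≈-refl ⟦ u₁ ⟧ (a j) ⟦ u₂ ⟧ ⟦ v₁ ⟧ ⟦ v₂ ⟧ ⟩
    ⟦ u₁ ⟧ * ((a j * (⟦ u₂ ⟧ * ⟦ v₁ ⟧) * a j) * ⟦ v₂ ⟧)
      ≈⟨ *-cong ≈-refl (*-cong (*-cong (*-cong ≈-refl (⟦++⟧ u₂ v₁)) ≈-refl) ≈-refl) ⟨
    ⟦ u₁ ⟧ * ((a j * ⟦ u₂ ++ v₁ ⟧ * a j) * ⟦ v₂ ⟧)
      ∎

  sandwich-commuting : ∀ j (w : List (Fin n)) → (∀ z → z ∈ w → Commutes (a j) z) → a j * ⟦ w ⟧ * a j ≈ 0#
  sandwich-commuting j w comm = begin
    a j * ⟦ w ⟧ * a j       ≈⟨ *-assoc _ _ _ ⟩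
    a j * (⟦ w ⟧ * a j)     ≈⟨ *-cong ≈-refl (commutes-⟦⟧ (a j) w comm) ⟨
    a j * (a j * ⟦ w ⟧)     ≈⟨ *-assoc _ _ _ ⟨
    (a j * a j) * ⟦ w ⟧     ≈⟨ *-cong (rel-sq j) ≈-refl ⟩
    0# * ⟦ w ⟧              ≈⟨ zeroˡ _ ⟩
    0#                      ∎

  sandwich-braid : ∀ j y (p q : List (Fin n)) → a j * a y * a j ≈ 0# →
                   (∀ z → z ∈ p → Commutes (a j) z) → (∀ z → z ∈ q → Commutes (a j) z) →
                   a j * ⟦ p ++ y ∷ q ⟧ * a j ≈ 0#
  sandwich-braid j y p q braid comm-p comm-q = begin
    a j * ⟦ p ++ y ∷ q ⟧ * a j                 ≈⟨ *-cong (*-cong ≈-refl (⟦++⟧ p (y ∷ q))) ≈-refl ⟩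
    a j * (⟦ p ⟧ * (a y * ⟦ q ⟧)) * a j        ≈⟨ solve 4 (λ J P Y Q → (J ⊕ (P ⊕ (Y ⊕ Q))) ⊕ J ⊜ ((J ⊕ P) ⊕ (Y ⊕ Q)) ⊕ J)
                                                          ≈-refl (a j) ⟦ p ⟧ (a y) ⟦ q ⟧ ⟩
    (a j * ⟦ p ⟧) * (a y * ⟦ q ⟧) * a j        ≈⟨ *-cong (*-cong (commutes-⟦⟧ (a j) p comm-p) ≈-refl) ≈-refl ⟩
    (⟦ p ⟧ * a j) * (a y * ⟦ q ⟧) * a j        ≈⟨ solve 4 (λ J P Y Q → ((P ⊕ J) ⊕ (Y ⊕ Q)) ⊕ J ⊜ P ⊕ ((J ⊕ Y) ⊕ (Q ⊕ J)))
                                                          ≈-refl (a j) ⟦ p ⟧ (a y) ⟦ q ⟧ ⟩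
    ⟦ p ⟧ * ((a j * a y) * (⟦ q ⟧ * a j))      ≈⟨ *-cong ≈-refl (*-cong ≈-refl (commutes-⟦⟧ (a j) q comm-q)) ⟨
    ⟦ p ⟧ * ((a j * a y) * (a j * ⟦ q ⟧))      ≈⟨ *-cong ≈-refl (*-assoc _ _ _) ⟨
    ⟦ p ⟧ * ((a j * a y * a j) * ⟦ q ⟧)        ≈⟨ *-cong ≈-refl (*-cong braid ≈-refl) ⟩
    ⟦ p ⟧ * (0# * ⟦ q ⟧)                       ≈⟨ ≈-trans (*-cong ≈-refl (zeroˡ _)) (zeroʳ _) ⟩
    0#                                         ∎

  Adjacent : Fin n → Fin n → Set
  Adjacent x y = y ≡ next x ⊎ x ≡ next y

  ⟦⟧-reorder : (w w' : List (Fin n)) → Unique w → Unique w' →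
               (∀ x → x ∈ w → x ∈ w') → (∀ x → x ∈ w' → x ∈ w) →
               (∀ x y → Adjacent x y → Before x y w → Before x y w') → ⟦ w ⟧ ≈ ⟦ w' ⟧
  ⟦⟧-reorder []      []        _  _  _    _    _     = ≈-refl
  ⟦⟧-reorder (x ∷ w) []        _  _  w⊆[] _    _     with () ← w⊆[] x (here refl)
  ⟦⟧-reorder w       (y ∷ w'') uw uw' w⊆w' w'⊆w order with ∈-∃++ (w'⊆w y (here refl))
  ... | p , q , refl = begin
    ⟦ p ++ y ∷ q ⟧      ≈⟨ ⟦⟧-extractˡ y p q commutes ⟩
    a y * ⟦ p ++ q ⟧    ≈⟨ *-cong ≈-refl (⟦⟧-reorder (p ++ q) w'' (unique-delete p q uw) (unique-tail uw')
                                                     ⊆w'' w''⊆ order'') ⟩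
    a y * ⟦ w'' ⟧       ∎
    where
    y∉pq = unique-middle p q uw
    commutes : ∀ z → z ∈ p → Commutes (a y) z
    commutes z z∈ = rel-comm y z (λ z≡ny → Before-head uw' (order z y (inj₂ z≡ny) (Before-before p q z∈)))
                                 (λ y≡nz → Before-head uw' (order z y (inj₁ y≡nz) (Before-before p q z∈)))
    ⊆w'' : ∀ x → x ∈ p ++ q → x ∈ w''
    ⊆w'' x x∈ with w⊆w' x (∈-insert y p q x∈)
    ... | here refl = ⊥-elim (y∉pq x∈)
    ... | there x∈w'' = x∈w''
    w''⊆ : ∀ x → x ∈ w'' → x ∈ p ++ q
    w''⊆ x x∈ = ∈-delete p q (w'⊆w x (there x∈)) (λ { refl → Unique[x∷xs]⇒x∉xs uw' x∈ })
    order'' : ∀ x z → Adjacent x z → Before x z (p ++ q) → Before x z w''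
    order'' x z adj b with order x z adj (Before-insert y p q b)
    ... | first _ = ⊥-elim (y∉pq (Before-∈ˡ b))
    ... | later b' = b'

shift : ∀ {n} {b c} {I J : Subset n} → (∃ λ x → lookup I x ≡ true × lookup J x ≡ true) →
        ∃ λ x → lookup (b ∷ I) x ≡ true × lookup (c ∷ J) x ≡ true
shift (x , x∈I , x∈J) = suc x , x∈I , x∈J

firstOut-∉ : ∀ {n} (I : Subset n) {j} → firstOut I ≡ just j → lookup I j ≡ false
firstOut-∉ (false ∷ I) refl = refl
firstOut-∉ (true ∷ I) eq with firstOut I in e
firstOut-∉ (true ∷ I) refl | just j = firstOut-∉ I e

firstOut-nothing : ∀ {n} (I : Subset n) → firstOut I ≡ nothing → ∣ I ∣ ≡ n
firstOut-nothing []          _  = refl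
firstOut-nothing (true ∷ I)  eq with firstOut I in e
... | nothing = cong suc (firstOut-nothing I e)

firstOut-just : ∀ {n} (I : Subset n) → ∣ I ∣ ≢ n → ∃ λ j → firstOut I ≡ just j
firstOut-just I ∣I∣≢n with firstOut I in e
... | just j  = j , refl
... | nothing = ⊥-elim (∣I∣≢n (firstOut-nothing I e))

lookup-∁ : ∀ {n} (I : Subset n) x → lookup (∁ I) x ≡ not (lookup I x)
lookup-∁ I x = lookup-map x not I

overlap-or-complement : ∀ {n} (I J : Subset n) → n ≤ ∣ I ∣ +ℕ ∣ J ∣ →
                        (∃ λ x → lookup I x ≡ true × lookup J x ≡ true) ⊎ J ≡ ∁ I
overlap-or-complement []         []         _  = inj₂ refl
overlap-or-complement (true ∷ I) (true ∷ J) _  = inj₁ (zero , refl , refl)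
overlap-or-complement (true ∷ I) (false ∷ J) (s≤s n≤) =
  Sum.map shift (cong (false ∷_)) (overlap-or-complement I J n≤)
overlap-or-complement {suc n} (false ∷ I) (true ∷ J) 1+n≤ =
  Sum.map shift (cong (true ∷_))
    (overlap-or-complement I J (ℕ.≤-pred (subst (suc n ≤_) (ℕ.+-suc ∣ I ∣ ∣ J ∣) 1+n≤)))
overlap-or-complement {suc n} (false ∷ I) (false ∷ J) 1+n≤
  with overlap-or-complement I J (ℕ.≤-trans (ℕ.n≤1+n n) 1+n≤)
... | inj₁ common = inj₁ (shift common)
... | inj₂ refl    = ⊥-elim (ℕ.<-irrefl (sym ∣I∣+∣∁I∣≡n) 1+n≤)
  where
  ∣I∣+∣∁I∣≡n : ∣ I ∣ +ℕ ∣ ∁ I ∣ ≡ n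
  ∣I∣+∣∁I∣≡n = trans (cong (∣ I ∣ +ℕ_) (∣∁p∣≡n∸∣p∣ I)) (ℕ.m+[n∸m]≡n (∣p∣≤n I))


allSubsets-unique : ∀ n → Unique (allSubsets n)
allSubsets-unique zero    = [] ∷ []
allSubsets-unique (suc n) =
  ++⁺ (map⁺ ∷-injectiveʳ (allSubsets-unique n)) (map⁺ ∷-injectiveʳ (allSubsets-unique n)) true-false-disjoint
  where
  ∷-injectiveʳ : ∀ {b} {I J : Subset n} → _≡_ {A = Subset (suc n)} (b ∷ I) (b ∷ J) → I ≡ J
  ∷-injectiveʳ refl = refl
  true-false-disjoint : ∀ {I} → ¬ (I ∈ map (true ∷_) (allSubsets n) × I ∈ map (false ∷_) (allSubsets n))
  true-false-disjoint (I∈t , I∈f) with ∈-map⁻ (true ∷_) I∈t | ∈-map⁻ (false ∷_) I∈f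
  ... | _ , _ , refl | _ , _ , ()

∈-allSubsets : ∀ {n} (I : Subset n) → I ∈ allSubsets n
∈-allSubsets []          = here refl
∈-allSubsets (true ∷ I)  = ∈-++⁺ˡ (∈-map⁺ (true ∷_) (∈-allSubsets I))
∈-allSubsets (false ∷ I) = ∈-++⁺ʳ (map (true ∷_) (allSubsets _)) (∈-map⁺ (false ∷_) (∈-allSubsets I))

subsetsOfSize-unique : ∀ n r → Unique (subsetsOfSize n r)
subsetsOfSize-unique n r = filter⁺ _ (allSubsets-unique n)

∈-subsetsOfSize⁺ : ∀ {n r} (I : Subset n) → ∣ I ∣ ≡ r → I ∈ subsetsOfSize n r
∈-subsetsOfSize⁺ I ∣I∣≡r = ∈-filter⁺ _ (∈-allSubsets I) (ℕ.≡⇒≡ᵇ _ _ ∣I∣≡r)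

∈-subsetsOfSize⁻ : ∀ {n r} {I : Subset n} → I ∈ subsetsOfSize n r → ∣ I ∣ ≡ r
∈-subsetsOfSize⁻ {n} I∈ = ℕ.≡ᵇ⇒≡ _ _ (proj₂ (∈-filter⁻ _ {xs = allSubsets n} I∈))

lookup-ext : ∀ {n} {I J : Subset n} → (∀ x → lookup I x ≡ lookup J x) → I ≡ J
lookup-ext {I = I} {J} eq = trans (sym (tabulate∘lookup I)) (trans (tabulate-cong eq) (tabulate∘lookup J))

subset-≢⇒difference : ∀ {n} {I J : Subset n} → I ≢ J →
  (∃ λ x → lookup I x ≡ true × lookup J x ≡ false) ⊎ (∃ λ x → lookup I x ≡ false × lookup J x ≡ true)
subset-≢⇒difference {n} {I} {J} I≢J
  with ¬∀⟶∃¬ n (λ x → lookup I x ≡ lookup J x) (λ x → lookup I x Bool.≟ lookup J x) (I≢J ∘ lookup-ext)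
... | x , Ix≢Jx with lookup I x in eI | lookup J x in eJ
... | true  | true  = ⊥-elim (Ix≢Jx refl)
... | true  | false = inj₁ (x , eI , eJ)
... | false | true  = inj₂ (x , eI , eJ)
... | false | false = ⊥-elim (Ix≢Jx refl)

∣[]≔∣ : ∀ {n} (I : Subset n) x b → ∣ I [ x ]≔ b ∣ +ℕ χ (lookup I x) ≡ ∣ I ∣ +ℕ χ b
∣[]≔∣ (true ∷ I)  zero    true  = refl
∣[]≔∣ (true ∷ I)  zero    false = ℕ.+-suc ∣ I ∣ 0
∣[]≔∣ (false ∷ I) zero    true  = sym (ℕ.+-suc ∣ I ∣ 0)
∣[]≔∣ (false ∷ I) zero    false = refl
∣[]≔∣ (true ∷ I)  (suc x) b     = cong suc (∣[]≔∣ I x b)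
∣[]≔∣ (false ∷ I) (suc x) b     = ∣[]≔∣ I x b

module Swap {n} (i i' : Fin n) (i≢i' : i ≢ i') where
  swap : Subset n → Subset n
  swap I = (I [ i ]≔ lookup I i') [ i' ]≔ lookup I i

  lookup-swapˡ : ∀ I → lookup (swap I) i ≡ lookup I i'
  lookup-swapˡ I = trans (lookup∘update′ i≢i' (I [ i ]≔ lookup I i') _) (lookup∘update i I _)

  lookup-swapʳ : ∀ I → lookup (swap I) i' ≡ lookup I i
  lookup-swapʳ I = lookup∘update i' (I [ i ]≔ lookup I i') _

  lookup-swap-other : ∀ I {x} → x ≢ i → x ≢ i' → lookup (swap I) x ≡ lookup I x
  lookup-swap-other I x≢i x≢i' = trans (lookup∘update′ x≢i' (I [ i ]≔ lookup I i') _) (lookup∘update′ x≢i I _)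

  swap-involutive : ∀ I → swap (swap I) ≡ I
  swap-involutive I = lookup-ext pointwise
    where
    pointwise : ∀ x → lookup (swap (swap I)) x ≡ lookup I x
    pointwise x with x ≟ i | x ≟ i'
    ... | yes refl | _        = trans (lookup-swapˡ (swap I)) (lookup-swapʳ I)
    ... | no _     | yes refl = trans (lookup-swapʳ (swap I)) (lookup-swapˡ I)
    ... | no x≢i   | no x≢i'  = trans (lookup-swap-other (swap I) x≢i x≢i') (lookup-swap-other I x≢i x≢i')

  ∣swap∣ : ∀ I → ∣ swap I ∣ ≡ ∣ I ∣
  ∣swap∣ I = ℕ.+-cancelʳ-≡ (χ (lookup I i')) _ _ (trans update-i' (∣[]≔∣ I i (lookup I i')))
    where
    I₁ = I [ i ]≔ lookup I i'
    update-i' : ∣ swap I ∣ +ℕ χ (lookup I i') ≡ ∣ I₁ ∣ +ℕ χ (lookup I i)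
    update-i' = trans (cong (λ b → ∣ swap I ∣ +ℕ χ b) (sym (lookup∘update′ (i≢i' ∘ sym) I _)))
                      (∣[]≔∣ I₁ i' (lookup I i))

-- Circular ribbons

module Ribbons (k : ℕ) where
  open Cyclic k
  open import Relation.Binary.Reasoning.Setoid (≈-setoid N)

  F : Set
  F = Fin N

  record Flank (j y y' : F) : Set where
    field
      braid    : a j * a y * a j ≈ 0#
      commutes : ∀ z → z ≢ y → z ≢ y' → Commutes (a j) z

  flank-next : ∀ j → Flank j (next j) (prev j)
  flank-next j = record
    { braid    = rel-braid₁ j
    ; commutes = λ z z≢nj z≢pj →
        rel-comm j z z≢nj (λ j≡nz → z≢pj (trans (sym (prev-next z)) (cong prev (sym j≡nz))))
    }

  flank-prev : ∀ j → Flank j (prev j) (next j)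
  flank-prev j = record
    { braid    = subst (λ t → a t * a (prev j) * a t ≈ 0#) (next-prev j) (rel-braid₂ (prev j))
    ; commutes = λ z z≢pj z≢nj → Flank.commutes (flank-next j) z z≢nj z≢pj
    }

  sandwich-vanishes : ∀ {j y y'} {w : List F} → Flank j y y' → (∀ z → z ∈ w → z ≢ y') → AtMostOnce y w →
                      a j * ⟦ w ⟧ * a j ≈ 0#
  sandwich-vanishes {j} {w = w} fl ≢y' (absent y∉w) =
    sandwich-commuting j w (λ z z∈ → Flank.commutes fl z (λ { refl → y∉w z∈ }) (≢y' z z∈))
  sandwich-vanishes {j} {y} fl ≢y' (once {p} {q} y∉pq) =
    sandwich-braid j y p q (Flank.braid fl)
      (λ z z∈ → Flank.commutes fl z (λ { refl → y∉pq (∈-++⁺ˡ z∈) }) (≢y' z (∈-++⁺ˡ z∈)))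
      (λ z z∈ → Flank.commutes fl z (λ { refl → y∉pq (∈-++⁺ʳ p z∈) }) (≢y' z (∈-++⁺ʳ p (there z∈))))

  -- Between the two occurrences of a_j every letter commutes with a_j except at most one a_y,
  -- so a_j a_j = 0 or a_j a_y a_j = 0 applies.
  product-vanishes : ∀ {j y y'} {u v : List F} → Flank j y y' → Unique u → Unique v → j ∈ u → j ∈ v →
                     ¬ Before j y' u → ¬ Before y' j v → ¬ Before j y u ⊎ ¬ Before y j v →
                     ⟦ u ⟧ * ⟦ v ⟧ ≈ 0#
  product-vanishes {j} {y} {y'} fl uu uv j∈u j∈v ¬jy'u ¬y'jv ¬y with ∈-∃++ j∈u | ∈-∃++ j∈v
  ... | u₁ , u₂ , refl | v₁ , v₂ , refl = begin
    ⟦ u₁ ++ j ∷ u₂ ⟧ * ⟦ v₁ ++ j ∷ v₂ ⟧                   ≈⟨ ⟦⟧-split-product j u₁ u₂ v₁ v₂ ⟩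
    ⟦ u₁ ⟧ * ((a j * ⟦ u₂ ++ v₁ ⟧ * a j) * ⟦ v₂ ⟧)         ≈⟨ *-cong ≈-refl (*-cong gap≈0 ≈-refl) ⟩
    ⟦ u₁ ⟧ * (0# * ⟦ v₂ ⟧)                                ≈⟨ ≈-trans (*-cong ≈-refl (zeroˡ _)) (zeroʳ _) ⟩
    0#                                                    ∎
    where
    ∉u₂ : ∀ {x} → ¬ Before j x (u₁ ++ j ∷ u₂) → x ∉ u₂
    ∉u₂ ¬b x∈ = ¬b (Before-after u₁ u₂ x∈)
    ∉v₁ : ∀ {x} → ¬ Before x j (v₁ ++ j ∷ v₂) → x ∉ v₁
    ∉v₁ ¬b x∈ = ¬b (Before-before v₁ v₂ x∈)
    ≢y' : ∀ z → z ∈ u₂ ++ v₁ → z ≢ y'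
    ≢y' z z∈ refl = [ ∉u₂ ¬jy'u , ∉v₁ ¬y'jv ]′ (∈-++⁻ u₂ z∈)
    atMostOnce : ¬ Before j y _ ⊎ ¬ Before y j _ → AtMostOnce y (u₂ ++ v₁)
    atMostOnce (inj₁ ¬jyu) = atMostOnce-++ʳ (∉u₂ ¬jyu) (unique⇒atMostOnce _≟_ (unique-++⁻ˡ v₁ uv))
    atMostOnce (inj₂ ¬yjv) = atMostOnce-++ˡ (unique⇒atMostOnce _≟_ (unique-tail (unique-++⁻ʳ u₁ uu))) (∉v₁ ¬yjv)
    gap≈0 : a j * ⟦ u₂ ++ v₁ ⟧ * a j ≈ 0#
    gap≈0 = sandwich-vanishes fl ≢y' (atMostOnce ¬y)

  -- The words of the circular ribbon indexed by I: each generator once, a_{x+1} before a_x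
  -- exactly when x + 1 ∈ I.
  record IsRibbon (I : Subset N) (w : List F) : Set where
    field
      unique      : Unique w
      complete    : ∀ x → x ∈ w
      next-before : ∀ x → lookup I (next x) ≡ true → Before (next x) x w
      next-after  : ∀ x → lookup I (next x) ≡ false → Before x (next x) w

    ¬before-next : ∀ j → lookup I (next j) ≡ true → ¬ Before j (next j) w
    ¬before-next j nj∈I b = Before-asym unique b (next-before j nj∈I)

    ¬after-next : ∀ j → lookup I (next j) ≡ false → ¬ Before (next j) j w
    ¬after-next j nj∉I b = Before-asym unique b (next-after j nj∉I)

    ¬before-prev : ∀ j → lookup I j ≡ false → ¬ Before j (prev j) w
    ¬before-prev j j∉I b = Before-asym unique b
      (subst (λ t → Before (prev j) t w) (next-prev j)
        (next-after (prev j) (subst (λ t → lookup I t ≡ false) (sym (next-prev j)) j∉I)))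

    ¬after-prev : ∀ j → lookup I j ≡ true → ¬ Before (prev j) j w
    ¬after-prev j j∈I b = Before-asym unique b
      (subst (λ t → Before t (prev j) w) (next-prev j)
        (next-before (prev j) (subst (λ t → lookup I t ≡ true) (sym (next-prev j)) j∈I)))

  ribbon-⟦⟧ : ∀ {I w w'} → IsRibbon I w → IsRibbon I w' → ⟦ w ⟧ ≈ ⟦ w' ⟧
  ribbon-⟦⟧ {I} {w} {w'} R R' =
    ⟦⟧-reorder w w' (R.unique) (R'.unique) (λ x _ → R'.complete x) (λ x _ → R.complete x) order
    where
    module R = IsRibbon R
    module R' = IsRibbon R'
    order : ∀ x y → Adjacent x y → Before x y w → Before x y w'
    order x _ (inj₁ refl) b with lookup I (next x) in e
    ... | true  = ⊥-elim (R.¬before-next x e b)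
    ... | false = R'.next-after x e
    order _ y (inj₂ refl) b with lookup I (next y) in e
    ... | true  = R'.next-before y e
    ... | false = ⊥-elim (R.¬after-next y e b)

  module W↓ = Walk _≟_ prev-distance
  module W↑ = Walk _≟_ next-distance

  ∈-walk↓ : ∀ j {x} → x ≢ j → x ∈ iterate prev (prev j) k
  ∈-walk↓ j {x} x≢j = W↓.∈-iterate⁺ k (prev j)
    (ℕ.≤∧≢⇒< (ℕ.≤-pred (dist↓-< (prev j) x))
             (λ d≡k → x≢j (W↓.dist-injective k (prev j) d≡k (dist↓-back j))))

  ∈-walk↑ : ∀ j {x} → x ≢ j → x ∈ iterate next (next j) k
  ∈-walk↑ j {x} x≢j = W↑.∈-iterate⁺ k (next j)
    (ℕ.≤∧≢⇒< (ℕ.≤-pred (dist↓-< x (next j)))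
             (λ d≡k → x≢j (W↑.dist-injective k (next j) d≡k (dist↓-next j))))

  clockwise counterclockwise : Subset N → F → List F
  clockwise        I j = filterᵇ (lookup I) (iterate prev (prev j) k)
  counterclockwise I j = filterᵇ (lookup I) (iterate next (next j) k)

  prodCW≡ : ∀ {I j} → firstOut I ≡ just j → prodCW I ≡ ⟦ clockwise I j ⟧
  prodCW≡ {I} eq with firstOut I
  prodCW≡ {I} {j} refl | just .j = cong (⟦_⟧ ∘ filterᵇ (lookup I)) (walkDown≡iterate k (prev j))

  prodCCW≡ : ∀ {I j} → firstOut I ≡ just j → prodCCW I ≡ ⟦ counterclockwise I j ⟧
  prodCCW≡ {I} eq with firstOut I
  prodCCW≡ {I} {j} refl | just .j = cong (⟦_⟧ ∘ filterᵇ (lookup I)) (walkUp≡iterate k (next j))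

  module Clockwise (I : Subset N) {j : F} (j∉I : lookup I j ≡ false) where
    ≢j : ∀ {x} → lookup I x ≡ true → x ≢ j
    ≢j x∈I refl = true≢false (trans (sym x∈I) j∉I)

    unique : Unique (clockwise I j)
    unique = filter⁺ (T? ∘ lookup I) (W↓.iterate-unique k (prev j) (ℕ.n≤1+n k))

    ∈⁺ : ∀ {x} → lookup I x ≡ true → x ∈ clockwise I j
    ∈⁺ x∈I = ∈-filter⁺ (T? ∘ lookup I) (∈-walk↓ j (≢j x∈I)) (Equivalence.from T-≡ x∈I)

    ∈⁻ : ∀ {x} → x ∈ clockwise I j → lookup I x ≡ true
    ∈⁻ x∈ = Equivalence.to T-≡ (proj₂ (∈-filter⁻ (T? ∘ lookup I) {xs = iterate prev (prev j) k} x∈))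

    before : ∀ {x} → lookup I x ≡ true → lookup I (next x) ≡ true → Before (next x) x (clockwise I j)
    before {x} x∈I nx∈I = Before-filter (lookup I) _ nx∈I x∈I
      (subst (λ t → Before (next x) t _) (prev-next x)
        (W↓.iterate-before k (prev j) (ℕ.n<1+n k) (∈-walk↓ j (≢j nx∈I))
          (subst (_∈ _) (sym (prev-next x)) (∈-walk↓ j (≢j x∈I)))))

  module Counterclockwise (I : Subset N) {j : F} (j∉I : lookup I j ≡ false) where
    ≢j : ∀ {x} → lookup I x ≡ true → x ≢ j
    ≢j x∈I refl = true≢false (trans (sym x∈I) j∉I)

    unique : Unique (counterclockwise I j)
    unique = filter⁺ (T? ∘ lookup I) (W↑.iterate-unique k (next j) (ℕ.n≤1+n k))

    ∈⁺ : ∀ {x} → lookup I x ≡ true → x ∈ counterclockwise I j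
    ∈⁺ x∈I = ∈-filter⁺ (T? ∘ lookup I) (∈-walk↑ j (≢j x∈I)) (Equivalence.from T-≡ x∈I)

    ∈⁻ : ∀ {x} → x ∈ counterclockwise I j → lookup I x ≡ true
    ∈⁻ x∈ = Equivalence.to T-≡ (proj₂ (∈-filter⁻ (T? ∘ lookup I) {xs = iterate next (next j) k} x∈))

    before : ∀ {x} → lookup I x ≡ true → lookup I (next x) ≡ true → Before x (next x) (counterclockwise I j)
    before x∈I nx∈I = Before-filter (lookup I) _ x∈I nx∈I
      (W↑.iterate-before k (next j) (ℕ.n<1+n k) (∈-walk↑ j (≢j x∈I)) (∈-walk↑ j (≢j nx∈I)))

  𝐌 : Subset N → Tm N
  𝐌 I = prodCW I * prodCCW (∁ I)

  record Nontrivial (I : Subset N) : Set where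
    field
      out       : F
      out-first : firstOut I ≡ just out
      inn       : F
      inn-first : firstOut (∁ I) ≡ just inn

    word : List F
    word = clockwise I out ++ counterclockwise (∁ I) inn

  canonical-ribbon : ∀ {I} (nt : Nontrivial I) → IsRibbon I (Nontrivial.word nt)
  canonical-ribbon {I} nt = record
    { unique      = ++⁺ CW.unique CCW.unique (λ (x∈cw , x∈ccw) → ∉-∁ (CW.∈⁻ x∈cw) (CCW.∈⁻ x∈ccw))
    ; complete    = complete
    ; next-before = next-before
    ; next-after  = next-after
    }
    where
    open Nontrivial nt
    module CW  = Clockwise I (firstOut-∉ I out-first)
    module CCW = Counterclockwise (∁ I) (firstOut-∉ (∁ I) inn-first)
    ∁⁺ : ∀ {x} → lookup I x ≡ false → lookup (∁ I) x ≡ true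
    ∁⁺ {x} x∉I = trans (lookup-∁ I x) (cong not x∉I)
    ∉-∁ : ∀ {x} → lookup I x ≡ true → ¬ lookup (∁ I) x ≡ true
    ∉-∁ {x} x∈I x∈∁I = true≢false (trans (sym x∈∁I) (trans (lookup-∁ I x) (cong not x∈I)))
    complete : ∀ x → x ∈ word
    complete x with lookup I x in e
    ... | true  = ∈-++⁺ˡ (CW.∈⁺ e)
    ... | false = ∈-++⁺ʳ _ (CCW.∈⁺ (∁⁺ e))
    next-before : ∀ x → lookup I (next x) ≡ true → Before (next x) x word
    next-before x nx∈I with lookup I x in e
    ... | true  = Before-++⁺ˡ _ _ (CW.before e nx∈I)
    ... | false = Before-++⁺ _ _ (CW.∈⁺ nx∈I) (CCW.∈⁺ (∁⁺ e))
    next-after : ∀ x → lookup I (next x) ≡ false → Before x (next x) word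
    next-after x nx∉I with lookup I x in e
    ... | true  = Before-++⁺ _ _ (CW.∈⁺ e) (CCW.∈⁺ (∁⁺ nx∉I))
    ... | false = Before-++⁺ʳ _ _ (CCW.before (∁⁺ e) (∁⁺ nx∉I))

  𝐌≈ribbon : ∀ {I w} → Nontrivial I → IsRibbon I w → 𝐌 I ≈ ⟦ w ⟧
  𝐌≈ribbon {I} {w} nt R = begin
    prodCW I * prodCCW (∁ I)                                  ≈⟨ ≈-reflexive (cong₂ _*_ (prodCW≡ {I} out-first)
                                                                                           (prodCCW≡ {∁ I} inn-first)) ⟩
    ⟦ clockwise I out ⟧ * ⟦ counterclockwise (∁ I) inn ⟧      ≈⟨ ⟦++⟧ (clockwise I out) _ ⟨
    ⟦ word ⟧                                                  ≈⟨ ribbon-⟦⟧ (canonical-ribbon nt) R ⟩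
    ⟦ w ⟧                                                     ∎
    where open Nontrivial nt

  boundary : (f : F → Bool) {y x : F} → f y ≡ false → f x ≡ true → ∃ λ p → f p ≡ false × f (next p) ≡ true
  boundary f {y} {x} fy≡f fx≡t
    with W↑.ascent (χ ∘ f) (subst₂ (λ b c → χ b < χ c) (sym fy≡f) (sym fx≡t) (s≤s z≤n))
  ... | p , up = p , χ-< up

  clockwise-counterclockwise-vanishes :
    ∀ {I J j₀ j₁} → lookup I j₀ ≡ false → lookup J j₁ ≡ false →
    (∃ λ x → lookup I x ≡ true × lookup J x ≡ true) → ⟦ clockwise I j₀ ⟧ * ⟦ counterclockwise J j₁ ⟧ ≈ 0#
  clockwise-counterclockwise-vanishes {I} {J} {j₀} {j₁} j₀∉I j₁∉J (x , x∈I , x∈J)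
    with boundary (λ z → lookup I z ∧ lookup J z) {j₀} (cong (_∧ lookup J j₀) j₀∉I) (cong₂ _∧_ x∈I x∈J)
  ... | p , p∉I∩J , j∈I∩J =
    product-vanishes (flank-prev j) CW.unique CCW.unique (CW.∈⁺ j∈I) (CCW.∈⁺ j∈J) ¬j≺nj ¬nj≺j
      (Sum.map ¬j≺pj ¬pj≺j
        (∧≡false (subst (λ t → lookup I t ∧ lookup J t ≡ false) (sym (prev-next p)) p∉I∩J)))
    where
    j = next p
    module CW  = Clockwise I j₀∉I
    module CCW = Counterclockwise J j₁∉J
    j∈I = proj₁ (∧≡true j∈I∩J)
    j∈J = proj₂ (∧≡true j∈I∩J)
    ¬j≺nj : ¬ Before j (next j) (clockwise I j₀)
    ¬j≺nj b = Before-asym CW.unique b (CW.before j∈I (CW.∈⁻ (Before-∈ʳ b)))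
    ¬nj≺j : ¬ Before (next j) j (counterclockwise J j₁)
    ¬nj≺j b = Before-asym CCW.unique b (CCW.before j∈J (CCW.∈⁻ (Before-∈ˡ b)))
    ¬j≺pj : lookup I (prev j) ≡ false → ¬ Before j (prev j) (clockwise I j₀)
    ¬j≺pj pj∉I b = true≢false (trans (sym (CW.∈⁻ (Before-∈ʳ b))) pj∉I)
    ¬pj≺j : lookup J (prev j) ≡ false → ¬ Before (prev j) j (counterclockwise J j₁)
    ¬pj≺j pj∉J b = true≢false (trans (sym (CCW.∈⁻ (Before-∈ˡ b))) pj∉J)

  module _ {m : ℕ} (1≤m : 1 ≤ m) (m≤k : m ≤ k) where
    ∣∁I∣≡N∸m : ∀ I → ∣ I ∣ ≡ m → ∣ ∁ I ∣ ≡ N ∸ m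
    ∣∁I∣≡N∸m I ∣I∣≡m = trans (∣∁p∣≡n∸∣p∣ I) (cong (N ∸_) ∣I∣≡m)

    N∸m≢N : N ∸ m ≢ N
    N∸m≢N e = ℕ.<-irrefl e (ℕ.≤-<-trans (ℕ.∸-monoʳ-≤ N 1≤m) (ℕ.n<1+n k))

    nontrivial : ∀ I → ∣ I ∣ ≡ m → Nontrivial I
    nontrivial I ∣I∣≡m = record
      { out = proj₁ out ; out-first = proj₂ out ; inn = proj₁ inn ; inn-first = proj₂ inn }
      where
      out = firstOut-just I (λ ∣I∣≡N → ℕ.<-irrefl (trans (sym ∣I∣≡m) ∣I∣≡N) (ℕ.≤-<-trans m≤k (ℕ.n<1+n k)))
      inn = firstOut-just (∁ I) (λ ∣∁I∣≡N → N∸m≢N (trans (sym (∣∁I∣≡N∸m I ∣I∣≡m)) ∣∁I∣≡N))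

    complementary-sizes : ∀ {i i'} → i ≡ m → i' ≡ N ∸ m → N ≤ i +ℕ i'
    complementary-sizes i≡m i'≡N∸m =
      ℕ.≤-reflexive (sym (trans (cong₂ _+ℕ_ i≡m i'≡N∸m) (ℕ.m+[n∸m]≡n (ℕ.m≤n⇒m≤1+n m≤k))))

    cross-terms-vanish : ∀ {I J} → ∣ I ∣ ≡ m → ∣ J ∣ ≡ N ∸ m → J ≢ ∁ I → prodCW I * prodCCW J ≈ 0#
    cross-terms-vanish {I} {J} ∣I∣≡m ∣J∣≡N∸m J≢∁I
      with overlap-or-complement I J (complementary-sizes ∣I∣≡m ∣J∣≡N∸m)
    ... | inj₂ J≡∁I = ⊥-elim (J≢∁I J≡∁I)
    ... | inj₁ common with firstOut-just J (λ ∣J∣≡N → N∸m≢N (trans (sym ∣J∣≡N∸m) ∣J∣≡N))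
    ...   | j₁ , j₁-first =
      ≈-trans (≈-reflexive (cong₂ _*_ (prodCW≡ {I} out-first) (prodCCW≡ {J} j₁-first)))
              (clockwise-counterclockwise-vanishes {I} {J} {out} {j₁}
                 (firstOut-∉ I out-first) (firstOut-∉ J j₁-first) common)
      where
      open Nontrivial (nontrivial I ∣I∣≡m)

    𝐳≈∑𝐌 : 𝐳 N m ≈ ∑ (subsetsOfSize N m) 𝐌
    𝐳≈∑𝐌 = ≈-trans (∑-distribʳ (subsetsOfSize N m) prodCW (𝐡 N (N ∸ m))) (∑-cong (subsetsOfSize N m) select)
      where
      select : ∀ I → I ∈ subsetsOfSize N m → prodCW I * 𝐡 N (N ∸ m) ≈ 𝐌 I
      select I I∈ = ≈-trans (∑-distribˡ (subsetsOfSize N (N ∸ m)) prodCCW (prodCW I))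
        (∑-point (λ J → prodCW I * prodCCW J) (subsetsOfSize-unique N (N ∸ m))
          (∈-subsetsOfSize⁺ (∁ I) (∣∁I∣≡N∸m I ∣I∣≡m))
          (λ J J∈ → cross-terms-vanish ∣I∣≡m (∈-subsetsOfSize⁻ J∈)))
        where ∣I∣≡m = ∈-subsetsOfSize⁻ I∈

  module _ {I J : Subset N} {u v : List F} (RI : IsRibbon I u) (RJ : IsRibbon J v) where
    private
      module RI = IsRibbon RI
      module RJ = IsRibbon RJ

    ribbons-vanish-entering : ∀ j → lookup I (next j) ≡ true → lookup J (next j) ≡ false →
                              lookup I j ≡ false ⊎ lookup J j ≡ true → ⟦ u ⟧ * ⟦ v ⟧ ≈ 0#
    ribbons-vanish-entering j nj∈I nj∉J j∉I⊎j∈J =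
      product-vanishes (flank-prev j) RI.unique RJ.unique (RI.complete j) (RJ.complete j)
        (RI.¬before-next j nj∈I) (RJ.¬after-next j nj∉J)
        (Sum.map (RI.¬before-prev j) (RJ.¬after-prev j) j∉I⊎j∈J)

    ribbons-vanish-leaving : ∀ j → lookup I j ≡ false → lookup J j ≡ true →
                             lookup I (next j) ≡ true ⊎ lookup J (next j) ≡ false → ⟦ u ⟧ * ⟦ v ⟧ ≈ 0#
    ribbons-vanish-leaving j j∉I j∈J nj∈I⊎nj∉J =
      product-vanishes (flank-next j) RI.unique RJ.unique (RI.complete j) (RJ.complete j)
        (RI.¬before-prev j j∉I) (RJ.¬after-prev j j∈J)
        (Sum.map (RI.¬before-next j) (RJ.¬after-next j) nj∈I⊎nj∉J)

  𝐌-orthogonal : ∀ {I J} → Nontrivial I → Nontrivial J → I ≢ J → 𝐌 I * 𝐌 J ≈ 0#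
  𝐌-orthogonal {I} {J} ntI ntJ I≢J =
    ≈-trans (*-cong (𝐌≈ribbon ntI RI) (𝐌≈ribbon ntJ RJ)) (vanish (subset-≢⇒difference I≢J))
    where
    RI = canonical-ribbon ntI
    RJ = canonical-ribbon ntJ
    onlyI onlyJ : F → Bool
    onlyI z = lookup I z ∧ not (lookup J z)
    onlyJ z = lookup J z ∧ not (lookup I z)
    vanish : (∃ λ x → lookup I x ≡ true × lookup J x ≡ false) ⊎
             (∃ λ x → lookup I x ≡ false × lookup J x ≡ true) →
             ⟦ Nontrivial.word ntI ⟧ * ⟦ Nontrivial.word ntJ ⟧ ≈ 0#
    vanish (inj₁ (x , x∈I , x∉J))
      with boundary onlyI (cong (_∧ _) (firstOut-∉ I (Nontrivial.out-first ntI)))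
                          (cong₂ (λ b c → b ∧ not c) x∈I x∉J)
    ... | j , j∉onlyI , nj∈onlyI =
      ribbons-vanish-entering RI RJ j (proj₁ (∧≡true nj∈onlyI)) (not≡true (proj₂ (∧≡true nj∈onlyI)))
        (Sum.map id not≡false (∧≡false j∉onlyI))
    vanish (inj₂ (x , x∉I , x∈J))
      with boundary (not ∘ onlyJ) (cong not (cong₂ (λ b c → b ∧ not c) x∈J x∉I))
                                  (cong (λ b → not (b ∧ _)) (firstOut-∉ J (Nontrivial.out-first ntJ)))
    ... | j , j∈onlyJ , nj∉onlyJ =
      ribbons-vanish-leaving RI RJ j (not≡true (proj₂ (∧≡true (not≡false j∈onlyJ))))
                                     (proj₁ (∧≡true (not≡false j∈onlyJ)))
        (Sum.map not≡false id (Sum.swap (∧≡false (not≡true nj∉onlyJ))))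

  ¬Before-singleton : ∀ {j x y : F} → ¬ Before x y (j ∷ [])
  ¬Before-singleton (first ())
  ¬Before-singleton (later ())

  module _ {I : Subset N} {w : List F} (R : IsRibbon I w) (j : F) where
    private module R = IsRibbon R

    ribbon*a≈0 : lookup I j ≡ false ⊎ lookup I (next j) ≡ true → ⟦ w ⟧ * a j ≈ 0#
    ribbon*a≈0 j∉I⊎nj∈I = ≈-trans (*-cong ≈-refl (≈-sym (*-identityʳ (a j)))) (vanish j∉I⊎nj∈I)
      where
      vanish : lookup I j ≡ false ⊎ lookup I (next j) ≡ true → ⟦ w ⟧ * ⟦ j ∷ [] ⟧ ≈ 0#
      vanish (inj₁ j∉I)  = product-vanishes (flank-next j) R.unique ([] ∷ []) (R.complete j) (here refl)
                             (R.¬before-prev j j∉I) ¬Before-singleton (inj₂ ¬Before-singleton)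
      vanish (inj₂ nj∈I) = product-vanishes (flank-prev j) R.unique ([] ∷ []) (R.complete j) (here refl)
                             (R.¬before-next j nj∈I) ¬Before-singleton (inj₂ ¬Before-singleton)

    a*ribbon≈0 : lookup I j ≡ true ⊎ lookup I (next j) ≡ false → a j * ⟦ w ⟧ ≈ 0#
    a*ribbon≈0 j∈I⊎nj∉I = ≈-trans (*-cong (≈-sym (*-identityʳ (a j))) ≈-refl) (vanish j∈I⊎nj∉I)
      where
      vanish : lookup I j ≡ true ⊎ lookup I (next j) ≡ false → ⟦ j ∷ [] ⟧ * ⟦ w ⟧ ≈ 0#
      vanish (inj₁ j∈I)  = product-vanishes (flank-next j) ([] ∷ []) R.unique (here refl) (R.complete j)
                             ¬Before-singleton (R.¬after-prev j j∈I) (inj₁ ¬Before-singleton)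
      vanish (inj₂ nj∉I) = product-vanishes (flank-prev j) ([] ∷ []) R.unique (here refl) (R.complete j)
                             ¬Before-singleton (R.¬after-next j nj∉I) (inj₁ ¬Before-singleton)

  module Centrality (1≤k : 1 ≤ k) (j : F) where
    nj≢j : next j ≢ j
    nj≢j = next≢id 1≤k j

    open Swap j (next j) (nj≢j ∘ sym)

    next-injective : ∀ {x y} → next x ≡ next y → x ≡ y
    next-injective {x} {y} e = trans (sym (prev-next x)) (trans (cong prev e) (prev-next y))

    swap-ribbon : ∀ {I} p q → IsRibbon I (p ++ j ∷ q) → lookup I j ≡ false → lookup I (next j) ≡ true →
                  IsRibbon (swap I) (j ∷ p ++ q)
    swap-ribbon {I} p q R j∉I nj∈I = record
      { unique      = All.¬Any⇒All¬ _ (unique-middle p q R.unique) ∷ unique-delete p q R.unique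
      ; complete    = complete
      ; next-before = next-before
      ; next-after  = next-after
      }
      where
      module R = IsRibbon R
      ∈pq : ∀ {x} → x ≢ j → x ∈ p ++ q
      ∈pq x≢j = ∈-delete p q (R.complete _) x≢j
      complete : ∀ x → x ∈ j ∷ p ++ q
      complete x with x ≟ j
      ... | yes refl = here refl
      ... | no  x≢j  = there (∈pq x≢j)
      unchanged : ∀ {x} → x ≢ j → next x ≢ j → lookup (swap I) (next x) ≡ lookup I (next x)
      unchanged x≢j nx≢j = lookup-swap-other I nx≢j (x≢j ∘ next-injective)
      next-before : ∀ x → lookup (swap I) (next x) ≡ true → Before (next x) x (j ∷ p ++ q)
      next-before x nx∈ with x ≟ j | next x ≟ j
      ... | yes refl | _        = ⊥-elim (true≢false (trans (sym nx∈) (trans (lookup-swapʳ I) j∉I)))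
      ... | no  x≢j  | yes nx≡j = subst (λ t → Before t x _) (sym nx≡j) (first (∈pq x≢j))
      ... | no  x≢j  | no  nx≢j =
        later (Before-delete p q (R.next-before x (trans (sym (unchanged x≢j nx≢j)) nx∈)) nx≢j x≢j)
      next-after : ∀ x → lookup (swap I) (next x) ≡ false → Before x (next x) (j ∷ p ++ q)
      next-after x nx∉ with x ≟ j | next x ≟ j
      ... | yes refl | _        = first (∈pq nj≢j)
      ... | no  x≢j  | yes refl =
        ⊥-elim (true≢false (trans (sym nj∈I) (trans (sym (lookup-swapˡ I)) nx∉)))
      ... | no  x≢j  | no  nx≢j =
        later (Before-delete p q (R.next-after x (trans (sym (unchanged x≢j nx≢j)) nx∉)) x≢j nx≢j)

    a*ribbon≈𝐌swap*a : ∀ {I w} → Nontrivial (swap I) → IsRibbon I w →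
                       lookup I j ≡ false → lookup I (next j) ≡ true → a j * ⟦ w ⟧ ≈ 𝐌 (swap I) * a j
    a*ribbon≈𝐌swap*a {I} nt R j∉I nj∈I with ∈-∃++ (IsRibbon.complete R j)
    ... | p , q , refl = begin
      a j * ⟦ p ++ j ∷ q ⟧       ≈⟨ *-cong ≈-refl (⟦⟧-extractʳ j p q commutes) ⟩
      a j * (⟦ p ++ q ⟧ * a j)   ≈⟨ *-assoc _ _ _ ⟨
      ⟦ j ∷ p ++ q ⟧ * a j       ≈⟨ *-cong (𝐌≈ribbon nt (swap-ribbon p q R j∉I nj∈I)) ≈-refl ⟨
      𝐌 (swap I) * a j           ∎
      where
      module R = IsRibbon R
      commutes : ∀ z → z ∈ q → Commutes (a j) z
      commutes z z∈q = Flank.commutes (flank-next j) z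
        (λ { refl → R.¬before-next j nj∈I (Before-after p q z∈q) })
        (λ { refl → R.¬before-prev j j∉I (Before-after p q z∈q) })

    isSource : Subset N → Bool
    isSource I = lookup I j ∧ not (lookup I (next j))

    sourceTerm : Subset N → Tm N
    sourceTerm I = if isSource I then 𝐌 I * a j else 0#

    𝐌*a≈sourceTerm : ∀ {I} → Nontrivial I → 𝐌 I * a j ≈ sourceTerm I
    𝐌*a≈sourceTerm {I} nt = ≈-if-∧-not (lookup I j) (lookup I (next j))
      (λ j∉I → ≈-trans (*-cong (𝐌≈ribbon nt R) ≈-refl) (ribbon*a≈0 R j (inj₁ j∉I)))
      (λ nj∈I → ≈-trans (*-cong (𝐌≈ribbon nt R) ≈-refl) (ribbon*a≈0 R j (inj₂ nj∈I)))
      (λ _ _ → ≈-refl)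
      where R = canonical-ribbon nt

    a*𝐌≈sourceTerm∘swap : ∀ {I} → Nontrivial I → Nontrivial (swap I) → a j * 𝐌 I ≈ sourceTerm (swap I)
    a*𝐌≈sourceTerm∘swap {I} nt nt-swap =
      ≈-trans by-cases (≈-reflexive (cong (λ b → if b then 𝐌 (swap I) * a j else 0#)
                                          (sym (cong₂ (λ b c → b ∧ not c) (lookup-swapˡ I) (lookup-swapʳ I)))))
      where
      R = canonical-ribbon nt
      by-cases : a j * 𝐌 I ≈ (if lookup I (next j) ∧ not (lookup I j) then 𝐌 (swap I) * a j else 0#)
      by-cases = ≈-trans (*-cong ≈-refl (𝐌≈ribbon nt R)) (≈-if-∧-not (lookup I (next j)) (lookup I j)
        (a*ribbon≈0 R j ∘ inj₂) (a*ribbon≈0 R j ∘ inj₁)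
        (λ nj∈I j∉I → a*ribbon≈𝐌swap*a nt-swap R j∉I nj∈I))

    a*𝐳≈𝐳*a : ∀ {m} → 1 ≤ m → m ≤ k → a j * 𝐳 N m ≈ 𝐳 N m * a j
    a*𝐳≈𝐳*a {m} 1≤m m≤k = begin
      a j * 𝐳 N m                     ≈⟨ *-cong ≈-refl (𝐳≈∑𝐌 1≤m m≤k) ⟩
      a j * ∑ S 𝐌                     ≈⟨ ∑-distribˡ S 𝐌 (a j) ⟩
      ∑ S (λ I → a j * 𝐌 I)           ≈⟨ ∑-cong S (λ _ I∈ → a*𝐌≈sourceTerm∘swap (nt I∈) (nt (swap∈S I∈))) ⟩
      ∑ S (sourceTerm ∘ swap)         ≈⟨ ∑-map S swap sourceTerm ⟨
      ∑ (map swap S) sourceTerm       ≈⟨ ∑-sameElements sourceTerm (map swap S) S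
                                             unique-swapS (subsetsOfSize-unique N m) swapS⊆S S⊆swapS ⟩
      ∑ S sourceTerm                  ≈⟨ ∑-cong S (λ I I∈ → 𝐌*a≈sourceTerm (nt I∈)) ⟨
      ∑ S (λ I → 𝐌 I * a j)           ≈⟨ ∑-distribʳ S 𝐌 (a j) ⟨
      ∑ S 𝐌 * a j                     ≈⟨ *-cong (𝐳≈∑𝐌 1≤m m≤k) ≈-refl ⟨
      𝐳 N m * a j                     ∎
      where
      S = subsetsOfSize N m
      nt : ∀ {I} → I ∈ S → Nontrivial I
      nt {I} I∈ = nontrivial 1≤m m≤k I (∈-subsetsOfSize⁻ I∈)
      swap∈S : ∀ {I} → I ∈ S → swap I ∈ S
      swap∈S {I} I∈ = ∈-subsetsOfSize⁺ (swap I) (trans (∣swap∣ I) (∈-subsetsOfSize⁻ I∈))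
      unique-swapS : Unique (map swap S)
      unique-swapS = map⁺ (λ {I} {J} e → trans (sym (swap-involutive I)) (trans (cong swap e) (swap-involutive J)))
                          (subsetsOfSize-unique N m)
      swapS⊆S : ∀ I → I ∈ map swap S → I ∈ S
      swapS⊆S I I∈ with ∈-map⁻ swap I∈
      ... | J , J∈ , refl = swap∈S J∈
      S⊆swapS : ∀ I → I ∈ S → I ∈ map swap S
      S⊆swapS I I∈ = subst (_∈ map swap S) (swap-involutive I) (∈-map⁺ swap (swap∈S I∈))

  module _ {p q : ℕ} (1≤p : 1 ≤ p) (p≤k : p ≤ k) (1≤q : 1 ≤ q) (q≤k : q ≤ k) (p≢q : p ≢ q) where
    𝐳-orthogonal : 𝐳 N p * 𝐳 N q ≈ 0#
    𝐳-orthogonal = begin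
      𝐳 N p * 𝐳 N q                    ≈⟨ *-cong (𝐳≈∑𝐌 1≤p p≤k) (𝐳≈∑𝐌 1≤q q≤k) ⟩
      ∑ Sp 𝐌 * ∑ Sq 𝐌                  ≈⟨ ∑-distribʳ Sp 𝐌 (∑ Sq 𝐌) ⟩
      ∑ Sp (λ I → 𝐌 I * ∑ Sq 𝐌)        ≈⟨ ∑-zero Sp (λ I I∈ → ≈-trans (∑-distribˡ Sq 𝐌 (𝐌 I))
                                                                     (∑-zero Sq (orthogonal I∈))) ⟩
      0#                               ∎
      where
      Sp = subsetsOfSize N p
      Sq = subsetsOfSize N q
      orthogonal : ∀ {I} → I ∈ Sp → ∀ J → J ∈ Sq → 𝐌 I * 𝐌 J ≈ 0#
      orthogonal {I} I∈ J J∈ = 𝐌-orthogonal (nontrivial 1≤p p≤k I ∣I∣≡p) (nontrivial 1≤q q≤k J ∣J∣≡q)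
                             (λ { refl → p≢q (trans (sym ∣I∣≡p) ∣J∣≡q) })
        where
        ∣I∣≡p = ∈-subsetsOfSize⁻ I∈
        ∣J∣≡q = ∈-subsetsOfSize⁻ J∈

lemma9p4 : (n : ℕ) → 2 ≤ n →
    ((m : ℕ) → 1 ≤ m → m ≤ n ∸ 1 → (x : Tm n) → 𝐳 n m * x ≈ x * 𝐳 n m)
    × ((k l : ℕ) → 1 ≤ k → k ≤ n ∸ 1 → 1 ≤ l → l ≤ n ∸ 1 → k ≢ l →
    𝐳 n k * 𝐳 n l ≈ 0#)
lemma9p4 (suc (suc k)) (s≤s (s≤s z≤n)) =
  (λ m 1≤m m≤k → central (𝐳 _ m) (λ j → Centrality.a*𝐳≈𝐳*a (s≤s z≤n) j 1≤m m≤k)) ,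
  (λ p q 1≤p p≤k 1≤q q≤k → 𝐳-orthogonal 1≤p p≤k 1≤q q≤k)
  where open Ribbons (suc k)
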